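{- Let $T$ and $T'$ be two unweighted degree-$d$ phylogenies with the same set of leaf labels, and let $b$ and $b'$ be the numbers of non-leaf-label-shared edges in $T$ (with respect to $T'$) and in $T'$ (with respect to $T$), respectively. Then $\mathrm{STTdist}(T,T')\ge\max(b,b')$.
   Context: A phylogeny is an unrooted tree whose leaves carry distinct labels and whose internal nodes have degree at least 3; degree-$d$ if every internal node has degree at most $d$. An edge $e$ of $T$ is leaf-label-shared (w.r.t. $T'$) if some edge $e'$ of $T'$ induces the same bipartition of leaf labels as $e$ (by removal); otherwise it is non-leaf-label-shared. STT operation: select a subtree $S$ attached to a node $u$ by an edge $e$; pick an edge $e'$ or an internal node $t$ not in $S$; detach $e$ with $S$ and re-attach them to a new node $x$ subdividing $e'$, or to $t$; if $u$ then has degree 2, merge its two incident edges. In the unweighted setting, its cost is the number of edges on the shortest path from $u$ to $x$ (resp. $t$). $\mathrm{STTdist}(T,T')$ is the minimum total cost of a sequence of STT operations transforming $T$ into a tree isomorphic to $T'$ via a leaf-label-preserving isomorphism. -}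

module Defs where

open import Data.Nat using (ℕ; zero; suc; _+_; _≤_)
open import Data.Fin using (Fin)
open import Data.List using (List; []; _∷_; length; _++_; [_])
open import Data.List.Relation.Unary.All using (All)
open import Data.List.Relation.Unary.AllPairs using (AllPairs)
open import Data.List.Relation.Unary.Unique.Propositional using (Unique)
open import Data.Maybe using (Maybe; just; nothing)
open import Data.Product using (Σ; ∃; ∃₂; _×_; _,_; proj₁)
open import Data.Sum using (_⊎_)
open import Data.Empty using (⊥)
open import Data.Unit using (⊤)
open import Relation.Nullary using (¬_)
open import Relation.Binary.PropositionalEquality using (_≡_; _≢_)
open import Function.Bundles using (_↔_; Inverse)

SameEdge : {V : Set} → V → V → V → V → Set
SameEdge a b c d = (a ≡ c × b ≡ d) ⊎ (a ≡ d × b ≡ c)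

module _ {V : Set} (R : V → V → Set) where

  data Walk : ℕ → V → V → Set where
    [] : ∀ {x} → Walk 0 x x
    _∷_ : ∀ {k x y z} → R x y → Walk k y z → Walk (suc k) x z

  Connected : Set
  Connected = ∀ x y → ∃ λ k → Walk k x y

  Chain : List V → Set
  Chain [] = ⊤
  Chain (x ∷ []) = ⊤
  Chain (x ∷ y ∷ r) = R x y × Chain (y ∷ r)

  HasCycle : Set
  HasCycle = Σ V λ v → Σ (List V) λ vs →
    Unique (v ∷ vs) × 2 ≤ length vs × Chain (v ∷ (vs ++ [ v ]))

  ShortestDist : V → V → ℕ → Set
  ShortestDist u w k = Walk k u w × (∀ m → Walk m u w → k ≤ m)

  IsLeaf : V → Set
  IsLeaf v = Σ V λ w → R v w × (∀ w' → R v w' → w' ≡ w)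

  DegGE3 : V → Set
  DegGE3 v = Σ V λ x → Σ V λ y → Σ V λ z →
    R v x × R v y × R v z × x ≢ y × x ≢ z × y ≢ z

  DegLE : ℕ → V → Set
  DegLE d v = ∀ (ws : List V) → Unique ws → All (R v) ws → length ws ≤ d

Minus : {V : Set} → (V → V → Set) → V → V → V → V → Set
Minus R a b p q = R p q × ¬ SameEdge p q a b

-- w lies in the component of b after removing the edge {a,b}
Side : {V : Set} → (V → V → Set) → V → V → V → Set
Side R a b w = ∃ λ k → Walk (Minus R a b) k w b

record Phylo (L : ℕ) : Set₁ where
  field
    V        : Set
    size     : ℕ
    finite   : V ↔ Fin size
    _~_      : V → V → Set
    ~-sym    : ∀ {x y} → x ~ y → y ~ x
    ~-irrefl : ∀ {x} → ¬ (x ~ x)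
    connected : Connected _~_
    acyclic  : ¬ HasCycle _~_
    lab      : Fin L → V
    lab-inj  : ∀ {i j} → lab i ≡ lab j → i ≡ j
    lab-leaf : ∀ i → IsLeaf _~_ (lab i)
    leaf-lab : ∀ v → IsLeaf _~_ v → ∃ λ i → lab i ≡ v
    internal-deg : ∀ v → ¬ IsLeaf _~_ v → DegGE3 _~_ v

DegreeD : ∀ {L} → ℕ → Phylo L → Set
DegreeD d T = ∀ v → ¬ IsLeaf _~_ v → DegLE _~_ d v
  where open Phylo T

_⇔_ : Set → Set → Set
P ⇔ Q = (P → Q) × (Q → P)

-- the edge {a,b} of T induces the same leaf bipartition as some edge of T'
Shared : ∀ {L} (T T' : Phylo L) → Phylo.V T → Phylo.V T → Set
Shared T T' a b = Σ (Phylo.V T') λ c → Σ (Phylo.V T') λ d → Phylo._~_ T' c d ×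
  ((∀ ℓ → Side (Phylo._~_ T) a b (Phylo.lab T ℓ) ⇔ Side (Phylo._~_ T') c d (Phylo.lab T' ℓ))
   ⊎ (∀ ℓ → Side (Phylo._~_ T) a b (Phylo.lab T ℓ) ⇔ Side (Phylo._~_ T') d c (Phylo.lab T' ℓ)))

-- es is a duplicate-free list of (oriented representatives of) edges of T
-- that are non-leaf-label-shared w.r.t. T'
NonSharedEdges : ∀ {L} (T T' : Phylo L) → List (Phylo.V T × Phylo.V T) → Set
NonSharedEdges T T' es =
  All (λ { (a , b) → Phylo._~_ T a b × ¬ Shared T T' a b }) es ×
  AllPairs (λ { (a , b) (c , d) → ¬ SameEdge a b c d }) es

record LGraph (L : ℕ) : Set₁ where
  field
    W     : Set
    adj   : W → W → Set
    IsLab : Fin L → W → Set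

toLGraph : ∀ {L} → Phylo L → LGraph L
toLGraph T = record { W = V ; adj = _~_ ; IsLab = λ ℓ w → lab ℓ ≡ w }
  where open Phylo T

record Iso {L} (H : Phylo L) (G : LGraph L) : Set where
  field
    bij     : Phylo.V H ↔ LGraph.W G
    adj-to  : ∀ {p q} → Phylo._~_ H p q → LGraph.adj G (Inverse.to bij p) (Inverse.to bij q)
    adj-from : ∀ {p q} → LGraph.adj G (Inverse.to bij p) (Inverse.to bij q) → Phylo._~_ H p q
    labels  : ∀ ℓ → LGraph.IsLab G ℓ (Inverse.to bij (Phylo.lab H ℓ))

module _ {L} (G : LGraph L) where
  open LGraph G

  TwoNbrs : W → W → W → Set
  TwoNbrs x p q = p ≢ q × adj x p × adj x q × (∀ w → adj x w → w ≡ p ⊎ w ≡ q)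

  Merge : W → W → W → LGraph L
  Merge x p q = record
    { W = Σ W λ w → w ≢ x
    ; adj = λ { (w₁ , _) (w₂ , _) → adj w₁ w₂ ⊎ SameEdge w₁ w₂ p q }
    ; IsLab = λ { ℓ (w , _) → IsLab ℓ w } }

  Suppress : W → Phylo L → Set
  Suppress x H =
    (Σ W λ p → Σ W λ q → TwoNbrs x p q × Iso H (Merge x p q))
    ⊎ ((¬ (Σ W λ p → Σ W λ q → TwoNbrs x p q)) × Iso H G)

module STTDefs {L} (T : Phylo L) where
  open Phylo T

  -- T with the edge {a,b} subdivided by a new node x = nothing
  subAdj : V → V → Maybe V → Maybe V → Set
  subAdj a b (just p) (just q) = p ~ q × ¬ SameEdge p q a b
  subAdj a b nothing  (just q) = q ≡ a ⊎ q ≡ b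
  subAdj a b (just p) nothing  = p ≡ a ⊎ p ≡ b
  subAdj a b nothing  nothing  = ⊥

  -- detach edge {u,v} (S on v's side) and re-attach v to x subdividing {a,b}
  regraftEdgeAdj : V → V → V → V → Maybe V → Maybe V → Set
  regraftEdgeAdj u v a b (just p) (just q) = subAdj a b (just p) (just q) × ¬ SameEdge p q u v
  regraftEdgeAdj u v a b nothing  (just q) = q ≡ a ⊎ q ≡ b ⊎ q ≡ v
  regraftEdgeAdj u v a b (just p) nothing  = p ≡ a ⊎ p ≡ b ⊎ p ≡ v
  regraftEdgeAdj u v a b nothing  nothing  = ⊥

  regraftEdge : V → V → V → V → LGraph L
  regraftEdge u v a b = record
    { W = Maybe V ; adj = regraftEdgeAdj u v a b ; IsLab = λ ℓ w → w ≡ just (lab ℓ) }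

  -- detach edge {u,v} (S on v's side) and re-attach v to node t
  regraftNode : V → V → V → LGraph L
  regraftNode u v t = record
    { W = V
    ; adj = λ p q → (p ~ q × ¬ SameEdge p q u v) ⊎ SameEdge p q t v
    ; IsLab = λ ℓ w → w ≡ lab ℓ }

  -- STT T H c : some STT operation of cost c turns T into H
  -- (the subtree S is the side of v after removing the edge e = {u,v})
  STT : Phylo L → ℕ → Set
  STT H c = Σ V λ u → Σ V λ v → u ~ v × (
      (Σ V λ a → Σ V λ b → a ~ b
         × ¬ Side _~_ u v a × ¬ Side _~_ u v b
         × ShortestDist (subAdj a b) (just u) nothing c
         × Suppress (regraftEdge u v a b) (just u) H)
    ⊎ (Σ V λ t → ¬ IsLeaf _~_ t × ¬ Side _~_ u v t
         × ShortestDist _~_ u t c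
         × Suppress (regraftNode u v t) u H))

open STTDefs public using (STT)

data STTSeq {L} : Phylo L → Phylo L → ℕ → Set₁ where
  done : ∀ {T} → STTSeq T T 0
  step : ∀ {T T₁ T₂ c₁ c₂} → STT T T₁ c₁ → STTSeq T₁ T₂ c₂ → STTSeq T T₂ (c₁ + c₂)

{-# OPTIONS --safe #-}
-- An STT operation of cost c moves the attachment uv of a subtree to tv along a path P of c edges.
-- Every edge of T off P lies over an edge of the new tree T₁ with the same leaf split, and every
-- edge of T₁ off P comes from one; the remaining edges are charged to the c edges of P, one each.
-- So T has at most c more edges not shared with T′ than T₁ has. On the side of T′ the same bound
-- holds: an edge of T′ shared with T₁ but not with T shares its split with a charged edge of T₁,
-- and distinct such edges of T′ land on distinct tokens, as distinct edges of a phylogeny have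
-- distinct splits. Once the tree is T′, every edge is shared.
module Submission where

open import Defs
open import Data.Empty using (⊥; ⊥-elim)
open import Data.Fin using (Fin; zero; suc) renaming (_<_ to _<ᶠ_)
open import Data.Fin.Properties using (injective⇒≤; <-cmp; inj⇒≟)
open import Data.List using (List; []; _∷_; length; _++_; [_]; lookup)
open import Data.List.Membership.Propositional using (_∈_)
open import Data.List.Membership.Propositional.Properties using (∈-∃++)
import Data.List.Membership.DecPropositional as DecMembership
open import Data.List.Properties using (length-++; ++-assoc)
open import Data.List.Relation.Unary.All using (All; []; _∷_; head; mapM)
open import Data.List.Relation.Unary.All.Properties using (¬Any⇒All¬; ++⁻ˡ; ++⁻ʳ)
open import Data.List.Relation.Unary.AllPairs using (AllPairs; []; _∷_)
open import Data.List.Relation.Unary.Any using (here; there)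
open import Data.List.Relation.Unary.Unique.Propositional using (Unique)
open import Data.List.Relation.Unary.Unique.Propositional.Properties using (Unique[x∷xs]⇒x∉xs)
open import Data.Maybe using (Maybe; just; nothing)
open import Data.Maybe.Properties using (just-injective) renaming (≡-dec to Maybe-≟)
open import Data.Nat using (ℕ; zero; suc; _+_; _≤_; _<_; z≤n; s≤s; _⊔_; _≤?_)
open import Data.Nat.Properties using (≤-refl; ≤-trans; +-suc; +-comm; +-mono-≤; ⊔-lub; <-≤-trans; n<1+n; <-irrefl; m≤m+n; ≤-reflexive; n≤1+n)
open import Data.Product using (Σ; ∃; _×_; _,_; proj₁; proj₂)
open import Data.Sum using (_⊎_; inj₁; inj₂)
open import Data.Unit using (⊤; tt)
open import Effect.Monad using (RawMonad)
open import Function.Bundles using (_↔_; Inverse)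
open import Function.Properties.Inverse using (↔⇒↣)
open import Level using (0ℓ)
open import Relation.Binary.Definitions using (DecidableEquality; tri<; tri≈; tri>)
open import Relation.Binary.PropositionalEquality using (_≡_; _≢_; refl; sym; trans; cong; subst; subst₂)
open import Relation.Nullary using (¬_; Dec; yes; no)
open import Relation.Nullary.Decidable using (decidable-stable; ¬¬-excluded-middle; _×-dec_; _⊎-dec_)
open import Relation.Nullary.Negation using (¬¬-Monad)

open RawMonad (¬¬-Monad {0ℓ}) using (return; _>>=_)

Reach : {V : Set} → (V → V → Set) → V → V → Set
Reach R x y = ∃ λ k → Walk R k x y

module _ {V : Set} {R : V → V → Set} where

  ε : ∀ {x} → Reach R x x
  ε = 0 , []

  infixr 5 _◅_ _◅◅_

  _◅_ : ∀ {x y z} → R x y → Reach R y z → Reach R x z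
  r ◅ (k , w) = suc k , r ∷ w

  single : ∀ {x y} → R x y → Reach R x y
  single r = r ◅ ε

  _◅◅_ : ∀ {x y z} → Reach R x y → Reach R y z → Reach R x z
  (k , w) ◅◅ (m , w′) = k + m , append w w′
    where
    append : ∀ {k m x y z} → Walk R k x y → Walk R m y z → Walk R (k + m) x z
    append [] w′ = w′
    append (r ∷ w) w′ = r ∷ append w w′

  reverse : (∀ {x y} → R x y → R y x) → ∀ {x y} → Reach R x y → Reach R y x
  reverse R-sym (_ , w) = go w
    where
    go : ∀ {k x y} → Walk R k x y → Reach R y x
    go [] = ε
    go (r ∷ w) = go w ◅◅ single (R-sym r)

reach-map : {V W : Set} {R : V → V → Set} {S : W → W → Set} (f : V → W) →
  (∀ {x y} → R x y → Reach S (f x) (f y)) → ∀ {x y} → Reach R x y → Reach S (f x) (f y)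
reach-map f h (_ , w) = go w
  where
  go : ∀ {k x y} → Walk _ k x y → Reach _ (f x) (f y)
  go [] = ε
  go (r ∷ w) = h r ◅◅ go w

reach-mono : {V : Set} {R S : V → V → Set} → (∀ {x y} → R x y → S x y) → ∀ {x y} → Reach R x y → Reach S x y
reach-mono f = reach-map (λ x → x) (λ r → single (f r))

reach-≡ : {V : Set} {R : V → V → Set} {x y : V} → x ≡ y → Reach R x y
reach-≡ refl = ε

module _ {V : Set} where

  SameEdge-refl : {a b : V} → SameEdge a b a b
  SameEdge-refl = inj₁ (refl , refl)

  SameEdge-swapˡ : {a b c d : V} → SameEdge a b c d → SameEdge b a c d
  SameEdge-swapˡ (inj₁ (p , q)) = inj₂ (q , p)
  SameEdge-swapˡ (inj₂ (p , q)) = inj₁ (q , p)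

  SameEdge-swapʳ : {a b c d : V} → SameEdge a b c d → SameEdge a b d c
  SameEdge-swapʳ (inj₁ (p , q)) = inj₂ (p , q)
  SameEdge-swapʳ (inj₂ (p , q)) = inj₁ (p , q)

  SameEdge-sym : {a b c d : V} → SameEdge a b c d → SameEdge c d a b
  SameEdge-sym (inj₁ (p , q)) = inj₁ (sym p , sym q)
  SameEdge-sym (inj₂ (p , q)) = inj₂ (sym q , sym p)

  SameEdge-trans : {a b c d e f : V} → SameEdge a b c d → SameEdge c d e f → SameEdge a b e f
  SameEdge-trans (inj₁ (refl , refl)) s = s
  SameEdge-trans (inj₂ (refl , refl)) s = SameEdge-swapˡ s

  ∉⇒¬SameEdge : {a b p q : V} → a ≢ p → a ≢ q → ¬ SameEdge p q a b
  ∉⇒¬SameEdge a≢p a≢q (inj₁ (e , _)) = a≢p (sym e)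
  ∉⇒¬SameEdge a≢p a≢q (inj₂ (_ , e)) = a≢q (sym e)

  SameEdge? : DecidableEquality V → (a b c d : V) → Dec (SameEdge a b c d)
  SameEdge? _≟_ a b c d = (a ≟ c ×-dec b ≟ d) ⊎-dec (a ≟ d ×-dec b ≟ c)

module _ {A B : Set} (f : A → B) where

  SameEdge-map : {a b c d : A} → SameEdge a b c d → SameEdge (f a) (f b) (f c) (f d)
  SameEdge-map (inj₁ (refl , refl)) = inj₁ (refl , refl)
  SameEdge-map (inj₂ (refl , refl)) = inj₂ (refl , refl)

  SameEdge-injective : (∀ {x y} → f x ≡ f y → x ≡ y) → {a b c d : A} →
    SameEdge (f a) (f b) (f c) (f d) → SameEdge a b c d
  SameEdge-injective inj (inj₁ (e₁ , e₂)) = inj₁ (inj e₁ , inj e₂)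
  SameEdge-injective inj (inj₂ (e₁ , e₂)) = inj₂ (inj e₁ , inj e₂)

Minus-sym : {V : Set} {R : V → V → Set} → (∀ {x y} → R x y → R y x) →
  ∀ {a b x y} → Minus R a b x y → Minus R a b y x
Minus-sym R-sym (r , n) = R-sym r , λ e → n (SameEdge-swapˡ e)

Minus-swap : {V : Set} {R : V → V → Set} → ∀ {a b x y} → Minus R b a x y → Minus R a b x y
Minus-swap (r , n) = r , λ e → n (SameEdge-swapʳ e)

module _ {A : Set} {D : A → A → Set} where

  AllPairs-lookup : (xs : List A) → AllPairs D xs →
    ∀ (i j : Fin (length xs)) → i <ᶠ j → D (lookup xs i) (lookup xs j)
  AllPairs-lookup (x ∷ xs) (a ∷ ap) zero (suc j) lt = lookup′ a j
    where
    lookup′ : ∀ {ys} → All (D x) ys → (j : Fin (length ys)) → D x (lookup ys j)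
    lookup′ (p ∷ _) zero = p
    lookup′ (_ ∷ ps) (suc j) = lookup′ ps j
  AllPairs-lookup (x ∷ xs) (a ∷ ap) (suc i) (suc j) (s≤s lt) = AllPairs-lookup xs ap i j lt

  AllPairs-length≤ : {n : ℕ} (f : A → Fin n) → (∀ {x y} → D x y → f x ≢ f y) →
    (xs : List A) → AllPairs D xs → length xs ≤ n
  AllPairs-length≤ f sep xs ap = injective⇒≤ injective
    where
    injective : ∀ {i j} → f (lookup xs i) ≡ f (lookup xs j) → i ≡ j
    injective {i} {j} e with <-cmp i j
    ... | tri< i<j _ _ = ⊥-elim (sep (AllPairs-lookup xs ap i j i<j) e)
    ... | tri≈ _ i≡j _ = i≡j
    ... | tri> _ _ j<i = ⊥-elim (sep (AllPairs-lookup xs ap j i j<i) (sym e))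

AllPairs-++⁻ˡ : {V : Set} {D : V → V → Set} (as bs : List V) → AllPairs D (as ++ bs) → AllPairs D as
AllPairs-++⁻ˡ [] bs _ = []
AllPairs-++⁻ˡ (a ∷ as) bs (p ∷ ps) = ++⁻ˡ as p ∷ AllPairs-++⁻ˡ as bs ps

Unique-++-∷⁻ : {V : Set} (zs : List V) {a : V} {ws : List V} → Unique (zs ++ a ∷ ws) → All (a ≢_) zs
Unique-++-∷⁻ [] _ = []
Unique-++-∷⁻ (z ∷ zs) (p ∷ ps) = (λ e → head (++⁻ʳ zs p) (sym e)) ∷ Unique-++-∷⁻ zs ps

Chain-++⁻ˡ : {V : Set} {R : V → V → Set} (as bs : List V) → Chain R (as ++ bs) → Chain R as
Chain-++⁻ˡ [] bs c = tt
Chain-++⁻ˡ (a ∷ []) bs c = tt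
Chain-++⁻ˡ (a ∷ a′ ∷ as) bs (r , c) = r , Chain-++⁻ˡ (a′ ∷ as) bs c

edges : {W : Set} → List W → List (W × W)
edges (x ∷ y ∷ r) = (x , y) ∷ edges (y ∷ r)
edges _ = []

data Path {V : Set} (R : V → V → Set) : V → V → List V → Set where
  pnil : ∀ {x} → Path R x x (x ∷ [])
  pcons : ∀ {x y z ys} → R x y → Path R y z ys → Path R x z (x ∷ ys)

module _ {V : Set} {R : V → V → Set} where

  walk→path : ∀ {k x y} → Walk R k x y → Σ (List V) (Path R x y)
  walk→path [] = _ , pnil
  walk→path (r ∷ w) = _ , pcons r (proj₂ (walk→path w))

  walk→path-edges : ∀ {k x y} (w : Walk R k x y) → length (edges (proj₁ (walk→path w))) ≡ k
  walk→path-edges [] = refl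
  walk→path-edges (r ∷ []) = refl
  walk→path-edges (r ∷ w@(_ ∷ _)) = cong suc (walk→path-edges w)

  path→walk : ∀ {x y xs} → Path R x y xs → Walk R (length (edges xs)) x y
  path→walk pnil = []
  path→walk (pcons r pnil) = r ∷ []
  path→walk (pcons r p@(pcons _ _)) = r ∷ path→walk p

  path→reach : ∀ {x y xs} → Path R x y xs → Reach R x y
  path→reach pnil = ε
  path→reach (pcons r p) = r ◅ path→reach p

  path-last : ∀ {x y xs} → Path R x y xs → y ∈ xs
  path-last pnil = here refl
  path-last (pcons _ p) = there (path-last p)

  path-chain : ∀ {x y xs} → Path R x y xs → Chain R xs
  path-chain pnil = tt
  path-chain (pcons r pnil) = r , tt
  path-chain (pcons r (pcons r′ p)) = r , path-chain (pcons r′ p)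

  path-snoc : ∀ {x y z xs} → Path R x y xs → R y z → Path R x z (xs ++ [ z ])
  path-snoc pnil r = pcons r pnil
  path-snoc (pcons r₀ p) r = pcons r₀ (path-snoc p r)

Path-mono : {V : Set} {R S : V → V → Set} → (∀ {x y} → R x y → S x y) → ∀ {x y xs} → Path R x y xs → Path S x y xs
Path-mono f pnil = pnil
Path-mono f (pcons r p) = pcons (f r) (Path-mono f p)

Path-avoid : {V : Set} {R : V → V → Set} {a : V} → ∀ {x y xs} → Path R x y xs → All (a ≢_) xs →
  Path (λ p q → R p q × a ≢ p × a ≢ q) x y xs
Path-avoid pnil _ = pnil
Path-avoid (pcons r pnil) (n₁ ∷ n₂ ∷ []) = pcons (r , n₁ , n₂) pnil
Path-avoid (pcons r (pcons r′ p)) (n₁ ∷ n₂ ∷ ns) = pcons (r , n₁ , n₂) (Path-avoid (pcons r′ p) (n₂ ∷ ns))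

Path-avoid-edge : {V : Set} {R : V → V → Set} {a b : V} → ∀ {x y xs} → Path R x y xs → All (a ≢_) xs →
  Path (Minus R a b) x y xs
Path-avoid-edge p a∉ = Path-mono (λ { (r , n₁ , n₂) → r , ∉⇒¬SameEdge n₁ n₂ }) (Path-avoid p a∉)

NonBacktracking : {V : Set} → List V → Set
NonBacktracking (x ∷ y ∷ z ∷ r) = x ≢ z × NonBacktracking (y ∷ z ∷ r)
NonBacktracking _ = ⊤

NonBacktracking-tail : {V : Set} {x : V} (xs : List V) → NonBacktracking (x ∷ xs) → NonBacktracking xs
NonBacktracking-tail [] _ = tt
NonBacktracking-tail (y ∷ []) _ = tt
NonBacktracking-tail (y ∷ z ∷ r) (_ , nb) = nb

module _ {V : Set} {R : V → V → Set} (_≟_ : DecidableEquality V) where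
  open DecMembership _≟_ using (_∈?_)

  nonBacktracking : ∀ {x y xs} → Path R x y xs → Σ (List V) λ ys → Path R x y ys × NonBacktracking ys
  nonBacktracking pnil = _ , pnil , tt
  nonBacktracking {x} (pcons r p) with nonBacktracking p
  ... | ._ , pnil , _ = _ , pcons r pnil , tt
  ... | ._ , pcons {y = w} r′ p′ , nb with w ≟ x
  ...   | yes refl = _ , p′ , NonBacktracking-tail _ nb
  ...   | no w≢x = _ , pcons r (pcons r′ p′) , extend p′ nb
    where
    extend : ∀ {y z ws} → Path R w z ws → NonBacktracking (y ∷ ws) → NonBacktracking (x ∷ y ∷ ws)
    extend pnil nb = (λ e → w≢x (sym e)) , tt
    extend (pcons _ _) nb = (λ e → w≢x (sym e)) , nb

  -- A repeated vertex closes a walk x, pre, x; it is a loop, a backtrack or a cycle.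
  nonBacktracking⇒Unique : (∀ {x} → ¬ R x x) → ¬ HasCycle R →
    ∀ {x y xs} → Path R x y xs → NonBacktracking xs → Unique xs
  nonBacktracking⇒Unique irr acyclic pnil _ = [] ∷ []
  nonBacktracking⇒Unique irr acyclic {x} (pcons {ys = ys} r p) nb
    with x ∈? ys | nonBacktracking⇒Unique irr acyclic p (NonBacktracking-tail _ nb)
  ... | no x∉ys | tail-unique = ¬Any⇒All¬ ys x∉ys ∷ tail-unique
  ... | yes x∈ys | tail-unique with ∈-∃++ x∈ys
  ...   | pre , post , refl = ⊥-elim (closed pre (path-chain (pcons r p)) nb tail-unique)
    where
    closed : ∀ pre → Chain R (x ∷ pre ++ x ∷ post) → NonBacktracking (x ∷ pre ++ x ∷ post) →
      Unique (pre ++ x ∷ post) → ⊥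
    closed [] (r , _) _ _ = irr r
    closed (_ ∷ []) _ (x≢x , _) _ = x≢x refl
    closed pre@(_ ∷ _ ∷ _) ch _ u =
      acyclic (x , pre , Unique-++-∷⁻ pre u ∷ AllPairs-++⁻ˡ pre (x ∷ post) u , s≤s (s≤s z≤n) ,
        Chain-++⁻ˡ (x ∷ pre ++ [ x ]) post (subst (Chain R) (cong (x ∷_) (sym (++-assoc pre [ x ] post))) ch))

⇔-sym : {A B : Set} → A ⇔ B → B ⇔ A
⇔-sym (f , g) = g , f

⇔-trans : {A B C : Set} → A ⇔ B → B ⇔ C → A ⇔ C
⇔-trans (f , g) (h , k) = (λ a → h (f a)) , (λ c → g (k c))

-- Shared T T′ a b unfolds to an edge c ~ d of T′ with the field of SameSplit T T′ a b c d or of SameSplit T T′ a b d c.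
record SameSplit {L} (T T′ : Phylo L) (p q : Phylo.V T) (a b : Phylo.V T′) : Set where
  constructor sameSplit
  field
    split : ∀ ℓ → Side (Phylo._~_ T) p q (Phylo.lab T ℓ) ⇔ Side (Phylo._~_ T′) a b (Phylo.lab T′ ℓ)
open SameSplit

SameSplit-sym : ∀ {L} {T₁ T₂ : Phylo L} {p q a b} → SameSplit T₁ T₂ p q a b → SameSplit T₂ T₁ a b p q
SameSplit-sym s = sameSplit λ ℓ → ⇔-sym (split s ℓ)

module _ {L : ℕ} {T₁ T₂ T₃ : Phylo L} where

  SameSplit-trans : ∀ {p q a b c d} → SameSplit T₁ T₂ p q a b → SameSplit T₂ T₃ a b c d → SameSplit T₁ T₃ p q c d
  SameSplit-trans s s′ = sameSplit λ ℓ → ⇔-trans (split s ℓ) (split s′ ℓ)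

  Shared-transport : ∀ {p q a b} → SameSplit T₁ T₂ p q a b → Shared T₂ T₃ a b → Shared T₁ T₃ p q
  Shared-transport s (c , d , r , inj₁ s′) = c , d , r , inj₁ (split (SameSplit-trans s (sameSplit s′)))
  Shared-transport s (c , d , r , inj₂ s′) = c , d , r , inj₂ (split (SameSplit-trans s (sameSplit s′)))

module Phylogeny {L : ℕ} (T : Phylo L) where
  open Phylo T

  _≟_ : DecidableEquality V
  _≟_ = inj⇒≟ (↔⇒↣ finite)

  Unique-length≤ : (xs : List V) → Unique xs → length xs ≤ size
  Unique-length≤ = AllPairs-length≤ (Inverse.to finite) λ x≢y e → x≢y (injective e)
    where open Function.Bundles.Injection (↔⇒↣ finite) using (injective)

  simple : ∀ {x y xs} → Path _~_ x y xs → NonBacktracking xs → Unique xs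
  simple = nonBacktracking⇒Unique _≟_ ~-irrefl acyclic

  ~⇒≢ : ∀ {x y} → x ~ y → x ≢ y
  ~⇒≢ r refl = ~-irrefl r

  no-triangle : ∀ {x y z} → x ~ y → y ~ z → z ~ x → ⊥
  no-triangle {x} {y} {z} xy yz zx = acyclic (x , y ∷ z ∷ [] ,
    (~⇒≢ xy ∷ (λ e → ~⇒≢ zx (sym e)) ∷ []) ∷ (~⇒≢ yz ∷ []) ∷ [] ∷ [] ,
    s≤s (s≤s z≤n) , xy , yz , zx , tt)

  -- A walk from a to b avoiding ab, closed up by ab, would be a cycle.
  Side-disjoint : ∀ {a b w} → a ~ b → Side _~_ a b w → Side _~_ b a w → ⊥
  Side-disjoint {a} {b} {w} ab s₁ s₂
    with walk→path (proj₂ (reverse (Minus-sym ~-sym) (reach-mono (Minus-swap {R = _~_}) s₂) ◅◅ s₁))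
  ... | xs , p with nonBacktracking _≟_ p
  ... | ._ , pnil , _ = ~-irrefl ab
  ... | ._ , pcons {y = y} (r , ab≢) p′ , nb =
    Unique[x∷xs]⇒x∉xs (simple (pcons (~-sym ab) (Path-mono proj₁ (pcons (r , ab≢) p′))) (extend p′ nb)) (there (path-last p′))
    where
    extend : ∀ {zs} → Path (Minus _~_ a b) y b zs → NonBacktracking (a ∷ zs) → NonBacktracking (b ∷ a ∷ zs)
    extend pnil nb = (λ e → ab≢ (inj₁ (refl , sym e))) , nb
    extend (pcons _ _) nb = (λ e → ab≢ (inj₁ (refl , sym e))) , nb

  Side-total : ∀ a b w → Side _~_ a b w ⊎ Side _~_ b a w
  Side-total a b w with to-either (proj₂ (connected w b))
    where
    to-either : ∀ {k w} → Walk _~_ k w b → Reach (Minus _~_ a b) w b ⊎ Reach (Minus _~_ a b) w a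
    to-either [] = inj₁ ε
    to-either {w = w} (_∷_ {y = y} r wk) with SameEdge? _≟_ w y a b
    ... | yes (inj₁ (refl , _)) = inj₂ ε
    ... | yes (inj₂ (refl , _)) = inj₁ ε
    ... | no ns with to-either wk
    ...   | inj₁ p = inj₁ ((r , ns) ◅ p)
    ...   | inj₂ p = inj₂ ((r , ns) ◅ p)
  ... | inj₁ p = inj₁ p
  ... | inj₂ p = inj₂ (reach-mono (Minus-swap {R = _~_}) p)

  Side-flip : ∀ {a b w} → ¬ Side _~_ a b w → Side _~_ b a w
  Side-flip {a} {b} {w} ¬s with Side-total a b w
  ... | inj₁ s = ⊥-elim (¬s s)
  ... | inj₂ s = s

  module _ {c d : V} where

    private
      R⁻ : V → V → Set
      R⁻ = Minus _~_ c d

    across-unique : ∀ {y x₁ x₂} → y ~ x₁ → SameEdge x₁ y c d → SameEdge x₂ y c d → x₁ ≡ x₂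
    across-unique r (inj₁ (refl , refl)) (inj₁ (refl , _)) = refl
    across-unique r (inj₁ (refl , refl)) (inj₂ (_ , refl)) = ⊥-elim (~-irrefl r)
    across-unique r (inj₂ (refl , refl)) (inj₁ (_ , refl)) = ⊥-elim (~-irrefl r)
    across-unique r (inj₂ (refl , refl)) (inj₂ (refl , _)) = refl

    -- At a vertex of degree ≥ 3, at most one neighbour is the previous vertex and at most one is across cd.
    onward : ∀ y prev → DegGE3 _~_ y → Σ V λ z → y ~ z × z ≢ prev × ¬ SameEdge z y c d
    onward y prev (x₁ , x₂ , x₃ , r₁ , r₂ , r₃ , n₁₂ , n₁₃ , n₂₃)
      with classify x₁ | classify x₂ | classify x₃
      where
      classify : ∀ x → (x ≢ prev × ¬ SameEdge x y c d) ⊎ (x ≡ prev ⊎ SameEdge x y c d)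
      classify x with x ≟ prev | SameEdge? _≟_ x y c d
      ... | yes e | _ = inj₂ (inj₁ e)
      ... | no _ | yes s = inj₂ (inj₂ s)
      ... | no n | no m = inj₁ (n , m)
    ... | inj₁ (g₁ , g₂) | _ | _ = x₁ , r₁ , g₁ , g₂
    ... | inj₂ _ | inj₁ (g₁ , g₂) | _ = x₂ , r₂ , g₁ , g₂
    ... | inj₂ _ | inj₂ _ | inj₁ (g₁ , g₂) = x₃ , r₃ , g₁ , g₂
    ... | inj₂ (inj₁ e₁) | inj₂ (inj₁ e₂) | inj₂ _ = ⊥-elim (n₁₂ (trans e₁ (sym e₂)))
    ... | inj₂ (inj₂ s₁) | inj₂ (inj₂ s₂) | inj₂ _ = ⊥-elim (n₁₂ (across-unique r₁ s₁ s₂))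
    ... | inj₂ (inj₁ e₁) | inj₂ (inj₂ _) | inj₂ (inj₁ e₃) = ⊥-elim (n₁₃ (trans e₁ (sym e₃)))
    ... | inj₂ (inj₁ _) | inj₂ (inj₂ s₂) | inj₂ (inj₂ s₃) = ⊥-elim (n₂₃ (across-unique r₂ s₂ s₃))
    ... | inj₂ (inj₂ _) | inj₂ (inj₁ e₂) | inj₂ (inj₁ e₃) = ⊥-elim (n₂₃ (trans e₂ (sym e₃)))
    ... | inj₂ (inj₂ s₁) | inj₂ (inj₁ _) | inj₂ (inj₂ s₃) = ⊥-elim (n₁₃ (across-unique r₁ s₁ s₃))

    module _ {a b : V} (ba : R⁻ b a) where

      private
        previous : List V → V
        previous [] = a
        previous (p ∷ _) = p

        Walker : Set
        Walker = Σ V λ ℓ → Σ (List V) λ zs → Path R⁻ ℓ b (ℓ ∷ zs) × NonBacktracking (ℓ ∷ zs ++ [ a ]) × IsLeaf _~_ ℓ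

        simple-walk : ∀ {y ys} → Path R⁻ y b (y ∷ ys) → NonBacktracking (y ∷ ys ++ [ a ]) → Unique ((y ∷ ys) ++ [ a ])
        simple-walk p nb = simple (Path-mono proj₁ (path-snoc p ba)) nb

        -- The path y … b a grows only at its front and stays simple, so within size steps y is a leaf.
        walk : (fuel : ℕ) → ∀ y ys → Path R⁻ y b (y ∷ ys) → NonBacktracking (y ∷ ys ++ [ a ]) →
          size < fuel + length (y ∷ ys) → ¬ ¬ Walker
        walk zero y ys p nb lt = λ _ → <-irrefl refl (<-≤-trans lt (≤-trans (≤-trans (m≤m+n (length (y ∷ ys)) 1)
          (≤-reflexive (sym (length-++ (y ∷ ys))))) (Unique-length≤ _ (simple-walk p nb))))
        walk (suc fuel) y ys p nb lt = ¬¬-excluded-middle >>= λ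
          { (yes leaf) → return (y , ys , p , nb , leaf)
          ; (no ¬leaf) → let (z , yz , z≢prev , ns) = onward y (previous ys) (internal-deg y ¬leaf) in
              walk fuel z (y ∷ ys) (pcons (~-sym yz , ns) p) (extend ys z≢prev nb)
                (subst (size <_) (sym (+-suc fuel (length (y ∷ ys)))) lt) }
          where
          extend : ∀ {z} ys → z ≢ previous ys → NonBacktracking (y ∷ ys ++ [ a ]) → NonBacktracking (z ∷ y ∷ ys ++ [ a ])
          extend [] z≢ nb = z≢ , nb
          extend (_ ∷ _) z≢ nb = z≢ , nb

      leaf-beyond : ¬ ¬ (Σ (Fin L) λ i → Side _~_ a b (lab i) × Reach R⁻ (lab i) b)
      leaf-beyond = walk size b [] pnil tt (subst (size <_) (+-comm 1 size) (n<1+n size)) >>= λ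
        { (ℓ , zs , p , nb , leaf) → let (i , lab≡) = leaf-lab ℓ leaf in
            return (i , subst (λ ℓ → Side _~_ a b ℓ × Reach R⁻ ℓ b) (sym lab≡)
              (path→reach (Path-avoid-edge (Path-mono proj₁ p) (Unique-++-∷⁻ (ℓ ∷ zs) (simple-walk p nb))) , path→reach p)) }

  -- Leaves beyond either end of ab, reached without crossing cd, separate ab from any other edge cd.
  SameSplit-injective : ∀ {a b c d} → a ~ b → c ~ d → SameSplit T T a b c d → SameEdge a b c d
  SameSplit-injective {a} {b} {c} {d} ab cd s = decidable-stable (SameEdge? _≟_ a b c d) λ ab≢cd →
    leaf-beyond (~-sym ab , λ e → ab≢cd (SameEdge-swapˡ e)) λ { (i , sᵢ , pᵢ) →
    leaf-beyond (ab , ab≢cd) λ { (j , sⱼ , pⱼ) →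
    Side-disjoint ab (proj₂ (split s j) (pⱼ ◅◅ single (ab , ab≢cd) ◅◅ reverse (Minus-sym ~-sym) pᵢ ◅◅ proj₁ (split s i) sᵢ)) sⱼ } }

SameSplit-flip : ∀ {L} {T T′ : Phylo L} {a b c d} → Phylo._~_ T a b → Phylo._~_ T′ c d →
  SameSplit T T′ a b c d → SameSplit T T′ b a d c
SameSplit-flip {T = T} {T′} ab cd s = sameSplit λ ℓ →
  (λ s₁ → Phylogeny.Side-flip T′ (λ s₂ → Phylogeny.Side-disjoint T ab (proj₂ (split s ℓ) s₂) s₁)) ,
  (λ s₁ → Phylogeny.Side-flip T (λ s₂ → Phylogeny.Side-disjoint T′ cd (proj₁ (split s ℓ) s₂) s₁))

record Graph (L : ℕ) : Set₁ where
  field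
    W : Set
    R : W → W → Set
    R-sym : ∀ {x y} → R x y → R y x
    _≟_ : DecidableEquality W
    label : Fin L → W

phylo-graph : ∀ {L} → Phylo L → Graph L
phylo-graph T = record
  { W = V ; R = _~_ ; R-sym = ~-sym ; _≟_ = Phylogeny._≟_ T ; label = lab }
  where open Phylo T

module _ {L : ℕ} (T : Phylo L) (G : Graph L) where
  open Phylo T
  open Graph G renaming (R to RG)

  record GraphIso : Set where
    field
      ι : V → W
      ι-injective : ∀ {p q} → ι p ≡ ι q → p ≡ q
      ι-surjective : ∀ w → Σ V λ p → ι p ≡ w
      ι-adj : ∀ {p q} → p ~ q → RG (ι p) (ι q)
      ι-adj⁻ : ∀ {p q} → RG (ι p) (ι q) → p ~ q
      ι-lab : ∀ ℓ → ι (lab ℓ) ≡ label ℓ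

  -- T is G with the degree-2 vertex x, adjacent to n₁ and n₂, suppressed.
  record Smoothing : Set where
    field
      ι : V → W
      ι-injective : ∀ {p q} → ι p ≡ ι q → p ≡ q
      x : W
      ι≢x : ∀ p → ι p ≢ x
      ι-surjective : ∀ w → w ≢ x → Σ V λ p → ι p ≡ w
      n₁ n₂ : W
      n₁≢n₂ : n₁ ≢ n₂
      n₁≢x : n₁ ≢ x
      n₂≢x : n₂ ≢ x
      x~n₁ : RG x n₁
      x~n₂ : RG x n₂
      x-nbrs : ∀ w → RG x w → w ≡ n₁ ⊎ w ≡ n₂
      n₁≁n₂ : ¬ RG n₁ n₂
      ι-adj : ∀ {p q} → p ~ q → RG (ι p) (ι q) ⊎ SameEdge (ι p) (ι q) n₁ n₂
      ι-adj⁻ : ∀ {p q} → RG (ι p) (ι q) → p ~ q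
      ι-merged⁻ : ∀ {p q} → SameEdge (ι p) (ι q) n₁ n₂ → p ~ q
      ι-lab : ∀ ℓ → ι (lab ℓ) ≡ label ℓ

  module GraphIso-Side (I : GraphIso) where
    open GraphIso I

    private
      κ : W → V
      κ w = proj₁ (ι-surjective w)

      κι : ∀ p → κ (ι p) ≡ p
      κι p = ι-injective (proj₂ (ι-surjective (ι p)))

    side : ∀ {p q w} → Side _~_ p q w → Side RG (ι p) (ι q) (ι w)
    side = reach-map ι (λ { (r , n) → single (ι-adj r , λ s → n (SameEdge-injective ι ι-injective s)) })

    side⁻ : ∀ {p q w} → Side RG (ι p) (ι q) (ι w) → Side _~_ p q w
    side⁻ {p} {q} {w} s = subst₂ (Reach (Minus _~_ p q)) (κι w) (κι q) (reach-map κ hop s)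
      where
      hop : ∀ {y z} → Minus RG (ι p) (ι q) y z → Reach (Minus _~_ p q) (κ y) (κ z)
      hop {y} {z} (r , n) = single (ι-adj⁻ (subst₂ RG (sym (proj₂ (ι-surjective y))) (sym (proj₂ (ι-surjective z))) r) ,
        λ s → n (subst₂ (λ a b → SameEdge a b (ι p) (ι q)) (proj₂ (ι-surjective y)) (proj₂ (ι-surjective z)) (SameEdge-map ι s)))

  -- Sides of an edge of T are sides of the corresponding edge of G; the merged edge n₁n₂ of T
  -- corresponds to either of the two G-edges at x.
  module Smoothing-Side (S : Smoothing) where
    open Smoothing S

    abstract
      κ : V → W → V
      κ d y with y ≟ x
      ... | yes _ = d
      ... | no y≢x = proj₁ (ι-surjective y y≢x)

      κ-x : ∀ d → κ d x ≡ d
      κ-x d with x ≟ x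
      ... | yes _ = refl
      ... | no x≢x = ⊥-elim (x≢x refl)

      ικ : ∀ d y → y ≢ x → ι (κ d y) ≡ y
      ικ d y y≢x with y ≟ x
      ... | yes e = ⊥-elim (y≢x e)
      ... | no y≢x′ = proj₂ (ι-surjective y y≢x′)

      ρ : W → W → W
      ρ d y with y ≟ x
      ... | yes _ = d
      ... | no _ = y

      ρ-x : ∀ d → ρ d x ≡ d
      ρ-x d with x ≟ x
      ... | yes _ = refl
      ... | no x≢x = ⊥-elim (x≢x refl)

      ρ-≢x : ∀ d y → y ≢ x → ρ d y ≡ y
      ρ-≢x d y y≢x with y ≟ x
      ... | yes e = ⊥-elim (y≢x e)
      ... | no _ = refl

    κι : ∀ d p → κ d (ι p) ≡ p
    κι d p = ι-injective (ικ d (ι p) (ι≢x p))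

    κ-adj : ∀ d {y z} → y ≢ x → z ≢ x → RG y z → κ d y ~ κ d z
    κ-adj d y≢x z≢x r = ι-adj⁻ (subst₂ RG (sym (ικ d _ y≢x)) (sym (ικ d _ z≢x)) r)

    κ-SameEdge : ∀ d {y z p q} → y ≢ x → z ≢ x → SameEdge (κ d y) (κ d z) p q → SameEdge y z (ι p) (ι q)
    κ-SameEdge d {p = p} {q} y≢x z≢x s =
      subst₂ (λ a b → SameEdge a b (ι p) (ι q)) (ικ d _ y≢x) (ικ d _ z≢x) (SameEdge-map ι s)

    x-nbr≢x : ∀ {w} → RG x w → w ≢ x
    x-nbr≢x r e with x-nbrs _ r
    ... | inj₁ refl = n₁≢x e
    ... | inj₂ refl = n₂≢x e

    edge≢n₁n₂ : ∀ {y z} → RG y z → ¬ SameEdge y z n₁ n₂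
    edge≢n₁n₂ r (inj₁ (refl , refl)) = n₁≁n₂ r
    edge≢n₁n₂ r (inj₂ (refl , refl)) = n₁≁n₂ (R-sym r)

    x-nbrs-merged : ∀ {p q} → SameEdge (ι p) (ι q) n₁ n₂ → ∀ {w} → RG x w → w ≡ ι p ⊎ w ≡ ι q
    x-nbrs-merged spq {w} r with x-nbrs w r | spq
    ... | inj₁ refl | inj₁ (e₁ , _) = inj₁ (sym e₁)
    ... | inj₁ refl | inj₂ (_ , e₂) = inj₂ (sym e₂)
    ... | inj₂ refl | inj₁ (_ , e₂) = inj₂ (sym e₂)
    ... | inj₂ refl | inj₂ (e₁ , _) = inj₁ (sym e₁)

    x~ι-target : ∀ {p q} → SameEdge (ι p) (ι q) n₁ n₂ → RG x (ι q)
    x~ι-target (inj₁ (_ , e₂)) = subst (RG x) (sym e₂) x~n₂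
    x~ι-target (inj₂ (_ , e₂)) = subst (RG x) (sym e₂) x~n₁

    x~ι-source : ∀ {p q} → SameEdge (ι p) (ι q) n₁ n₂ → RG x (ι p)
    x~ι-source spq = x~ι-target (SameEdge-swapˡ spq)

    merged-ι≢ : ∀ {p q} → SameEdge (ι p) (ι q) n₁ n₂ → ι p ≢ ι q
    merged-ι≢ (inj₁ (e₁ , e₂)) e = n₁≢n₂ (trans (sym e₁) (trans e e₂))
    merged-ι≢ (inj₂ (e₁ , e₂)) e = n₁≢n₂ (trans (sym e₂) (trans (sym e) e₁))

    x-edge≢ι : ∀ {y p q} → ¬ SameEdge x y (ι p) (ι q)
    x-edge≢ι (inj₁ (e , _)) = ι≢x _ (sym e)
    x-edge≢ι (inj₂ (e , _)) = ι≢x _ (sym e)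

    side : ∀ {p q w} → Side _~_ p q w → Side RG (ι p) (ι q) (ι w)
    side {p} {q} = reach-map ι hop
      where
      through-x : ∀ {a b} → ι a ≡ n₁ → ι b ≡ n₂ → Reach (Minus RG (ι p) (ι q)) (ι a) (ι b)
      through-x e₁ e₂ = (subst (λ c → RG c x) (sym e₁) (R-sym x~n₁) , λ s → x-edge≢ι (SameEdge-swapˡ s)) ◅
                        single (subst (RG x) (sym e₂) x~n₂ , x-edge≢ι)
      hop : ∀ {a b} → Minus _~_ p q a b → Reach (Minus RG (ι p) (ι q)) (ι a) (ι b)
      hop (r , n) with ι-adj r
      ... | inj₁ r′ = single (r′ , λ s → n (SameEdge-injective ι ι-injective s))
      ... | inj₂ (inj₁ (e₁ , e₂)) = through-x e₁ e₂
      ... | inj₂ (inj₂ (e₁ , e₂)) = reverse (Minus-sym R-sym) (through-x e₂ e₁)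

    side⁻ : ∀ {p q w} → RG (ι p) (ι q) → Side RG (ι p) (ι q) (ι w) → Side _~_ p q w
    side⁻ {p} {q} {w} rpq s = subst₂ (Reach (Minus _~_ p q)) (κι d w) (κι d q) (reach-map (κ d) hop s)
      where
      d : V
      d = proj₁ (ι-surjective n₁ n₁≢x)
      ιd : ι d ≡ n₁
      ιd = proj₂ (ι-surjective n₁ n₁≢x)
      merged : SameEdge (ι d) (ι (κ d n₂)) n₁ n₂
      merged = subst₂ (λ a b → SameEdge a b n₁ n₂) (sym ιd) (sym (ικ d n₂ n₂≢x)) SameEdge-refl
      from-x : ∀ {z} → RG x z → Reach (Minus _~_ p q) d (κ d z)
      from-x {z} r with x-nbrs z r
      ... | inj₁ refl = reach-≡ (ι-injective (trans ιd (sym (ικ d n₁ n₁≢x))))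
      ... | inj₂ refl = single (ι-merged⁻ merged ,
        λ s → edge≢n₁n₂ rpq (SameEdge-trans (SameEdge-sym (SameEdge-map ι s)) merged))
      hop : ∀ {y z} → Minus RG (ι p) (ι q) y z → Reach (Minus _~_ p q) (κ d y) (κ d z)
      hop {y} {z} (r , n) with y ≟ x | z ≟ x
      ... | yes refl | yes refl = ε
      ... | yes refl | no _ = subst (λ c → Reach (Minus _~_ p q) c (κ d z)) (sym (κ-x d)) (from-x r)
      ... | no _ | yes refl = subst (Reach (Minus _~_ p q) (κ d y)) (sym (κ-x d))
                                (reverse (Minus-sym ~-sym) (from-x (R-sym r)))
      ... | no y≢x | no z≢x = single (κ-adj d y≢x z≢x r , λ s → n (κ-SameEdge d y≢x z≢x s))

    side-merged : ∀ {p q w} → SameEdge (ι p) (ι q) n₁ n₂ → Side _~_ p q w → Side RG x (ι q) (ι w)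
    side-merged {p} {q} spq = reach-map ι hop
      where
      hop : ∀ {a b} → Minus _~_ p q a b → Reach (Minus RG x (ι q)) (ι a) (ι b)
      hop {a} {b} (r , n) with ι-adj r
      ... | inj₁ r′ = single (r′ , λ { (inj₁ (e , _)) → ι≢x a e ; (inj₂ (_ , e)) → ι≢x b e })
      ... | inj₂ s = ⊥-elim (n (SameEdge-injective ι ι-injective (SameEdge-trans s (SameEdge-sym spq))))

    side-merged⁻ : ∀ {p q w} → SameEdge (ι p) (ι q) n₁ n₂ → Side RG x (ι q) (ι w) → Side _~_ p q w
    side-merged⁻ {p} {q} {w} spq s = subst₂ (Reach (Minus _~_ p q)) (κι p w) (κι p q) (reach-map (κ p) hop s)
      where
      hop : ∀ {y z} → Minus RG x (ι q) y z → Reach (Minus _~_ p q) (κ p y) (κ p z)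
      hop {y} {z} (r , n) with y ≟ x | z ≟ x
      ... | yes refl | yes refl = ε
      ... | yes refl | no _ with x-nbrs-merged spq r
      ...   | inj₁ refl = subst (λ c → Reach (Minus _~_ p q) c (κ p (ι p))) (sym (κ-x p)) (reach-≡ (sym (κι p p)))
      ...   | inj₂ refl = ⊥-elim (n SameEdge-refl)
      hop {y} {z} (r , n) | no _ | yes refl with x-nbrs-merged spq (R-sym r)
      ...   | inj₁ refl = subst (Reach (Minus _~_ p q) (κ p (ι p))) (sym (κ-x p)) (reach-≡ (κι p p))
      ...   | inj₂ refl = ⊥-elim (n (inj₂ (refl , refl)))
      hop {y} {z} (r , n) | no y≢x | no z≢x =
        single (κ-adj p y≢x z≢x r , λ s → edge≢n₁n₂ r (SameEdge-trans (κ-SameEdge p y≢x z≢x s) spq))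

    -- Contracting x onto one of its two neighbours identifies the sides of the two edges at x.
    x-sides : ∀ {p q w} → SameEdge (ι p) (ι q) n₁ n₂ → w ≢ x → Side RG x (ι q) w → Side RG (ι p) x w
    x-sides {p} {q} {w} spq w≢x s =
      subst₂ (Reach (Minus RG (ι p) x)) (ρ-≢x (ι p) w w≢x) (ρ-≢x (ι p) (ι q) (ι≢x q)) (reach-map (ρ (ι p)) hop s) ◅◅
        single (R-sym (x~ι-target spq) , λ { (inj₁ (e , _)) → merged-ι≢ spq (sym e) ; (inj₂ (e , _)) → ι≢x q e })
      where
      hop : ∀ {y z} → Minus RG x (ι q) y z → Reach (Minus RG (ι p) x) (ρ (ι p) y) (ρ (ι p) z)
      hop {y} {z} (r , n) with y ≟ x | z ≟ x
      ... | yes refl | yes refl = ε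
      ... | yes refl | no _ with x-nbrs-merged spq r
      ...   | inj₁ refl = reach-≡ (trans (ρ-x (ι p)) (sym (ρ-≢x (ι p) (ι p) (ι≢x p))))
      ...   | inj₂ refl = ⊥-elim (n SameEdge-refl)
      hop {y} {z} (r , n) | no _ | yes refl with x-nbrs-merged spq (R-sym r)
      ...   | inj₁ refl = reach-≡ (trans (ρ-≢x (ι p) (ι p) (ι≢x p)) (sym (ρ-x (ι p))))
      ...   | inj₂ refl = ⊥-elim (n (inj₂ (refl , refl)))
      hop {y} {z} (r , n) | no y≢x | no z≢x rewrite ρ-≢x (ι p) y y≢x | ρ-≢x (ι p) z z≢x =
        single (r , λ { (inj₁ (_ , e)) → z≢x e ; (inj₂ (e , _)) → y≢x e })

    x-sides⁻ : ∀ {p q w} → SameEdge (ι p) (ι q) n₁ n₂ → w ≢ x → Side RG (ι p) x w → Side RG x (ι q) w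
    x-sides⁻ {p} {q} {w} spq w≢x s =
      subst₂ (Reach (Minus RG x (ι q))) (ρ-≢x (ι q) w w≢x) (ρ-x (ι q)) (reach-map (ρ (ι q)) hop s)
      where
      hop : ∀ {y z} → Minus RG (ι p) x y z → Reach (Minus RG x (ι q)) (ρ (ι q) y) (ρ (ι q) z)
      hop {y} {z} (r , n) with y ≟ x | z ≟ x
      ... | yes refl | yes refl = ε
      ... | yes refl | no _ with x-nbrs-merged spq r
      ...   | inj₁ refl = ⊥-elim (n (inj₂ (refl , refl)))
      ...   | inj₂ refl = reach-≡ (trans (ρ-x (ι q)) (sym (ρ-≢x (ι q) (ι q) (ι≢x q))))
      hop {y} {z} (r , n) | no _ | yes refl with x-nbrs-merged spq (R-sym r)
      ...   | inj₁ refl = ⊥-elim (n SameEdge-refl)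
      ...   | inj₂ refl = reach-≡ (trans (ρ-≢x (ι q) (ι q) (ι≢x q)) (sym (ρ-x (ι q))))
      hop {y} {z} (r , n) | no y≢x | no z≢x rewrite ρ-≢x (ι q) y y≢x | ρ-≢x (ι q) z z≢x =
        single (r , λ { (inj₁ (e , _)) → y≢x e ; (inj₂ (_ , e)) → z≢x e })

OffPath : {W : Set} → W → W → List W → Set
OffPath c d xs = Chain (λ y z → ¬ SameEdge y z c d) xs

Path-restrict : {W : Set} {S Q : W → W → Set} → ∀ {x y xs} → Path S x y xs → Chain Q xs →
  Path (λ a b → S a b × Q a b) x y xs
Path-restrict pnil _ = pnil
Path-restrict (pcons r pnil) (q , _) = pcons (r , q) pnil
Path-restrict (pcons r (pcons r′ p)) (q , c) = pcons (r , q) (Path-restrict (pcons r′ p) c)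

-- K′ is K with the edge uv replaced by tv, where t is joined to u by a path P avoiding v and uv.
module Regraft {W : Set} (_≟_ : DecidableEquality W) (K K′ : W → W → Set)
  (K-sym : ∀ {x y} → K x y → K y x) (K′-sym : ∀ {x y} → K′ x y → K′ y x)
  (u v t : W)
  (K′⇒ : ∀ {p q} → K′ p q → (K p q × ¬ SameEdge p q u v) ⊎ SameEdge p q t v)
  (K⇒K′ : ∀ {p q} → K p q → ¬ SameEdge p q u v → K′ p q)
  (t~′v : K′ t v) (u~v : K u v)
  (ps : List W) (P : Path (Minus K u v) u t ps) (v∉P : All (v ≢_) ps)
  (t∉side : ¬ Side K u v t) where

  K-edge≢tv : ∀ {y z} → K y z → ¬ SameEdge y z u v → ¬ SameEdge y z t v
  K-edge≢tv r ns (inj₁ (refl , refl)) = t∉side (single (r , ns))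
  K-edge≢tv r ns (inj₂ (refl , refl)) = t∉side (single (K-sym r , λ s → ns (SameEdge-swapˡ s)))

  P-reach : Reach (Minus K u v) u t
  P-reach = path→reach P

  P-reach′ : Reach (Minus K′ v t) u t
  P-reach′ = path→reach (Path-mono (λ { ((r , ns) , n₁ , n₂) → K⇒K′ r ns , ∉⇒¬SameEdge n₁ n₂ }) (Path-avoid P v∉P))

  module OffPathEdge (c d : W) (cd≢uv : ¬ SameEdge c d u v) (cd≢tv : ¬ SameEdge c d t v) (off : OffPath c d ps) where

    P-reach-off : Reach (Minus K c d) u t
    P-reach-off = path→reach (Path-mono (λ { ((r , ns) , n) → r , n }) (Path-restrict P off))

    P-reach-off′ : Reach (Minus K′ c d) u t
    P-reach-off′ = path→reach (Path-mono (λ { ((r , ns) , n) → K⇒K′ r ns , n }) (Path-restrict P off))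

    -- The lost edge uv is rerouted along P and the new edge tv.
    side : ∀ {w} → Side K c d w → Side K′ c d w
    side = reach-map (λ z → z) hop
      where
      hop : ∀ {y z} → Minus K c d y z → Reach (Minus K′ c d) y z
      hop {y} {z} (r , n) with SameEdge? _≟_ y z u v
      ... | yes (inj₁ (refl , refl)) = P-reach-off′ ◅◅ single (t~′v , λ s → cd≢tv (SameEdge-sym s))
      ... | yes (inj₂ (refl , refl)) = single (K′-sym t~′v , λ s → cd≢tv (SameEdge-sym (SameEdge-swapˡ s))) ◅◅
                                         reverse (Minus-sym K′-sym) P-reach-off′
      ... | no ns = single (K⇒K′ r ns , n)

    side⁻ : ∀ {w} → Side K′ c d w → Side K c d w
    side⁻ = reach-map (λ z → z) hop
      where
      hop : ∀ {y z} → Minus K′ c d y z → Reach (Minus K c d) y z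
      hop {y} {z} (r , n) with K′⇒ r
      ... | inj₁ (r′ , _) = single (r′ , n)
      ... | inj₂ (inj₁ (refl , refl)) = reverse (Minus-sym K-sym) P-reach-off ◅◅ single (u~v , λ s → cd≢uv (SameEdge-sym s))
      ... | inj₂ (inj₂ (refl , refl)) = single (K-sym u~v , λ s → cd≢uv (SameEdge-sym (SameEdge-swapˡ s))) ◅◅ P-reach-off

  private
    hop-uv→tv : ∀ {y z} → Minus K u v y z → Reach (Minus K′ t v) y z
    hop-uv→tv (r , ns) = single (K⇒K′ r ns , K-edge≢tv r ns)

    hop-tv→uv : ∀ {y z} → Minus K′ t v y z → Reach (Minus K u v) y z
    hop-tv→uv (r , n) with K′⇒ r
    ... | inj₁ (r′ , ns) = single (r′ , ns)
    ... | inj₂ s = ⊥-elim (n s)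

  side-moved : ∀ {w} → Side K u v w → Side K′ t v w
  side-moved = reach-map (λ z → z) hop-uv→tv

  side-moved⁻ : ∀ {w} → Side K′ t v w → Side K u v w
  side-moved⁻ = reach-map (λ z → z) hop-tv→uv

  -- The subtree side of the moved edge is unchanged, the rest is now reached through P.
  side-moved-opp : ∀ {w} → Side K v u w → Side K′ v t w
  side-moved-opp s = reach-map (λ z → z) (λ e → reach-mono (Minus-swap {R = K′}) (hop-uv→tv (Minus-swap {R = K} e))) s ◅◅ P-reach′

  side-moved-opp⁻ : ∀ {w} → Side K′ v t w → Side K v u w
  side-moved-opp⁻ s = reach-mono (Minus-swap {R = K}) (reach-map (λ z → z) (λ e → hop-tv→uv (Minus-swap {R = K′} e)) s ◅◅ reverse (Minus-sym K-sym) P-reach)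

module Link {L : ℕ} (S : Phylo L) (G : Graph L) where
  open Phylo S
  open Graph G renaming (R to RG)

  Link : Set
  Link = GraphIso S G ⊎ Smoothing S G

  embed : Link → V → W
  embed (inj₁ I) = GraphIso.ι I
  embed (inj₂ M) = Smoothing.ι M

  embed-lab : (l : Link) → ∀ ℓ → embed l (lab ℓ) ≡ label ℓ
  embed-lab (inj₁ I) = GraphIso.ι-lab I
  embed-lab (inj₂ M) = Smoothing.ι-lab M

  -- The edge pq of S lies over the edge yz of G (a merged edge lies over both G-edges at x).
  Over : Link → V → V → W → W → Set
  Over (inj₁ I) p q y z = ι p ≡ y × ι q ≡ z
    where open GraphIso I
  Over (inj₂ M) p q y z = (RG (ι p) (ι q) × ι p ≡ y × ι q ≡ z) ⊎
                          (SameEdge (ι p) (ι q) n₁ n₂ × ((y ≡ x × z ≡ ι q) ⊎ (y ≡ ι p × z ≡ x)))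
    where open Smoothing M

  AtX : Link → W → W → Set
  AtX (inj₁ _) y z = ⊥
  AtX (inj₂ M) y z = y ≡ Smoothing.x M ⊎ z ≡ Smoothing.x M

  Over-adj : (l : Link) → ∀ {p q y z} → p ~ q → Over l p q y z → RG y z
  Over-adj (inj₁ I) r (refl , refl) = GraphIso.ι-adj I r
  Over-adj (inj₂ M) r (inj₁ (r′ , refl , refl)) = r′
  Over-adj (inj₂ M) r (inj₂ (spq , inj₁ (refl , refl))) = Smoothing-Side.x~ι-target S G M spq
  Over-adj (inj₂ M) r (inj₂ (spq , inj₂ (refl , refl))) = R-sym (Smoothing-Side.x~ι-source S G M spq)

  Over-adj⁻ : (l : Link) → ∀ {p q y z} → RG y z → Over l p q y z → p ~ q
  Over-adj⁻ (inj₁ I) r (refl , refl) = GraphIso.ι-adj⁻ I r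
  Over-adj⁻ (inj₂ M) r (inj₁ (r′ , refl , refl)) = Smoothing.ι-adj⁻ M r′
  Over-adj⁻ (inj₂ M) r (inj₂ (spq , _)) = Smoothing.ι-merged⁻ M spq

  Over-side : (l : Link) → ∀ {p q y z} → Over l p q y z → ∀ w → Side _~_ p q w ⇔ Side RG y z (embed l w)
  Over-side (inj₁ I) (refl , refl) w = side , side⁻
    where open GraphIso-Side S G I
  Over-side (inj₂ M) (inj₁ (r , refl , refl)) w = side , side⁻ r
    where open Smoothing-Side S G M
  Over-side (inj₂ M) (inj₂ (spq , inj₁ (refl , refl))) w = side-merged spq , side-merged⁻ spq
    where open Smoothing-Side S G M
  Over-side (inj₂ M) (inj₂ (spq , inj₂ (refl , refl))) w =
    (λ s → x-sides spq (Smoothing.ι≢x M w) (side-merged spq s)) ,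
    (λ s → side-merged⁻ spq (x-sides⁻ spq (Smoothing.ι≢x M w) s))
    where open Smoothing-Side S G M

  Over-injective : (l : Link) → ∀ {p q y z p′ q′ y′ z′} → Over l p q y z → Over l p′ q′ y′ z′ →
    SameEdge y z y′ z′ → SameEdge p q p′ q′
  Over-injective (inj₁ I) (refl , refl) (refl , refl) s = SameEdge-injective (GraphIso.ι I) (GraphIso.ι-injective I) s
  Over-injective (inj₂ M) (inj₁ (_ , refl , refl)) (inj₁ (_ , refl , refl)) s =
    SameEdge-injective (Smoothing.ι M) (Smoothing.ι-injective M) s
  Over-injective (inj₂ M) (inj₂ (s₁ , _)) (inj₂ (s₂ , _)) _ =
    SameEdge-injective (Smoothing.ι M) (Smoothing.ι-injective M) (SameEdge-trans s₁ (SameEdge-sym s₂))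
  Over-injective (inj₂ M) (inj₁ (_ , refl , refl)) (inj₂ (_ , inj₁ (refl , refl))) s =
    ⊥-elim (Smoothing-Side.x-edge≢ι S G M (SameEdge-sym s))
  Over-injective (inj₂ M) (inj₁ (_ , refl , refl)) (inj₂ (_ , inj₂ (refl , refl))) s =
    ⊥-elim (Smoothing-Side.x-edge≢ι S G M (SameEdge-swapˡ (SameEdge-sym s)))
  Over-injective (inj₂ M) (inj₂ (_ , inj₁ (refl , refl))) (inj₁ (_ , refl , refl)) s =
    ⊥-elim (Smoothing-Side.x-edge≢ι S G M s)
  Over-injective (inj₂ M) (inj₂ (_ , inj₂ (refl , refl))) (inj₁ (_ , refl , refl)) s =
    ⊥-elim (Smoothing-Side.x-edge≢ι S G M (SameEdge-swapˡ s))

  Over-functional : (l : Link) → ∀ {p q y z p′ q′ y′ z′} → Over l p q y z → Over l p′ q′ y′ z′ →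
    SameEdge p q p′ q′ → SameEdge y z y′ z′ ⊎ (AtX l y z × AtX l y′ z′)
  Over-functional (inj₁ I) (refl , refl) (refl , refl) s = inj₁ (SameEdge-map (GraphIso.ι I) s)
  Over-functional (inj₂ M) (inj₁ (_ , refl , refl)) (inj₁ (_ , refl , refl)) s = inj₁ (SameEdge-map (Smoothing.ι M) s)
  Over-functional (inj₂ M) (inj₂ (_ , c₁)) (inj₂ (_ , c₂)) s = inj₂ (at-x c₁ , at-x c₂)
    where
    at-x : ∀ {a b y z} → (y ≡ Smoothing.x M × z ≡ a) ⊎ (y ≡ b × z ≡ Smoothing.x M) → AtX (inj₂ M) y z
    at-x (inj₁ (e , _)) = inj₁ e
    at-x (inj₂ (_ , e)) = inj₂ e
  Over-functional (inj₂ M) (inj₁ (r , refl , refl)) (inj₂ (s′ , _)) s =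
    ⊥-elim (Smoothing-Side.edge≢n₁n₂ S G M r (SameEdge-trans (SameEdge-map (Smoothing.ι M) s) s′))
  Over-functional (inj₂ M) (inj₂ (s′ , _)) (inj₁ (r , refl , refl)) s =
    ⊥-elim (Smoothing-Side.edge≢n₁n₂ S G M r (SameEdge-trans (SameEdge-map (Smoothing.ι M) (SameEdge-sym s)) s′))

  Over-surjective : (l : Link) → ∀ {y z} → RG y z → Σ V λ p → Σ V λ q → Over l p q y z
  Over-surjective (inj₁ I) {y} {z} r = proj₁ (ι-surjective y) , proj₁ (ι-surjective z) , proj₂ (ι-surjective y) , proj₂ (ι-surjective z)
    where open GraphIso I
  Over-surjective (inj₂ M) = over
    where
    open Smoothing M
    merged-preimage : ∀ {a b} → SameEdge a b n₁ n₂ → Σ V λ p → Σ V λ q → ι p ≡ a × ι q ≡ b × SameEdge (ι p) (ι q) n₁ n₂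
    merged-preimage {a} {b} s with ι-surjective n₁ n₁≢x | ι-surjective n₂ n₂≢x | s
    ... | p₁ , e₁ | p₂ , e₂ | inj₁ (refl , refl) = p₁ , p₂ , e₁ , e₂ , inj₁ (e₁ , e₂)
    ... | p₁ , e₁ | p₂ , e₂ | inj₂ (refl , refl) = p₂ , p₁ , e₂ , e₁ , inj₂ (e₂ , e₁)
    over : ∀ {y z} → RG y z → Σ V λ p → Σ V λ q → Over (inj₂ M) p q y z
    over {y} {z} r with y ≟ x | z ≟ x
    ... | yes refl | yes refl = ⊥-elim (Smoothing-Side.x-nbr≢x S G M r refl)
    ... | yes refl | no _ = let (p , q , _ , e , s) = merged-preimage (proj₂ (other (x-nbrs z r))) in p , q , inj₂ (s , inj₁ (refl , sym e))
      where
      other : ∀ {z} → z ≡ n₁ ⊎ z ≡ n₂ → Σ W λ a → SameEdge a z n₁ n₂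
      other (inj₁ refl) = n₂ , inj₂ (refl , refl)
      other (inj₂ refl) = n₁ , inj₁ (refl , refl)
    ... | no _ | yes refl = let (p , q , e , _ , s) = merged-preimage (proj₂ (other (x-nbrs y (R-sym r)))) in p , q , inj₂ (s , inj₂ (sym e , refl))
      where
      other : ∀ {y} → y ≡ n₁ ⊎ y ≡ n₂ → Σ W λ b → SameEdge y b n₁ n₂
      other (inj₁ refl) = n₂ , inj₁ (refl , refl)
      other (inj₂ refl) = n₁ , inj₂ (refl , refl)
    ... | no y≢x | no z≢x =
      proj₁ (ι-surjective y y≢x) , proj₁ (ι-surjective z z≢x) ,
      inj₁ (subst₂ RG (sym (proj₂ (ι-surjective y y≢x))) (sym (proj₂ (ι-surjective z z≢x))) r ,
            proj₂ (ι-surjective y y≢x) , proj₂ (ι-surjective z z≢x))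

  Over-candidates : (l : Link) → ∀ {p q} → p ~ q →
    Σ (W × W) λ k₀ → Σ (List (W × W)) λ ks → All (λ { (y , z) → Over l p q y z }) (k₀ ∷ ks)
  Over-candidates (inj₁ I) {p} {q} r = (GraphIso.ι I p , GraphIso.ι I q) , [] , (refl , refl) ∷ []
  Over-candidates (inj₂ M) {p} {q} r with Smoothing.ι-adj M r
  ... | inj₁ r′ = (Smoothing.ι M p , Smoothing.ι M q) , [] , inj₁ (r′ , refl , refl) ∷ []
  ... | inj₂ s = (Smoothing.x M , Smoothing.ι M q) , (Smoothing.ι M p , Smoothing.x M) ∷ [] ,
                 inj₂ (s , inj₁ (refl , refl)) ∷ inj₂ (s , inj₂ (refl , refl)) ∷ []

-- The n tokens stand for the edges of the path along which the subtree is moved.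
record Forward {L} (T T₁ : Phylo L) (n : ℕ) : Set₁ where
  field
    Charged : Phylo.V T → Phylo.V T → Fin n → Set
    Carried : Phylo.V T → Phylo.V T → Phylo.V T₁ → Phylo.V T₁ → Set
    classify : ∀ {p q} → Phylo._~_ T p q → (Σ (Fin n) (Charged p q)) ⊎
      (Σ (Phylo.V T₁) λ a → Σ (Phylo.V T₁) λ b → Carried p q a b × Phylo._~_ T₁ a b × SameSplit T T₁ p q a b)
    charged-unique : ∀ {p q p′ q′ i} → Charged p q i → Charged p′ q′ i → SameEdge p q p′ q′
    carried-injective : ∀ {p q a b p′ q′ a′ b′} → Carried p q a b → Carried p′ q′ a′ b′ →
      SameEdge a b a′ b′ → SameEdge p q p′ q′

record Backward {L} (T T₁ : Phylo L) (n : ℕ) : Set₁ where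
  field
    Charged : Phylo.V T₁ → Phylo.V T₁ → Fin n → Set
    classify : ∀ {a b} → Phylo._~_ T₁ a b → (Σ (Fin n) (Charged a b)) ⊎
      (Σ (Phylo.V T) λ p → Σ (Phylo.V T) λ q → Phylo._~_ T p q × SameSplit T₁ T a b p q)
    charged-unique : ∀ {a b a′ b′ i} → Charged a b i → Charged a′ b′ i → SameEdge a b a′ b′

module _ {W : Set} where

  OnPath : W → W → (ps : List W) → Fin (length (edges ps)) → Set
  OnPath c d ps i = SameEdge c d (proj₁ (lookup (edges ps) i)) (proj₂ (lookup (edges ps) i))

  OffPath? : DecidableEquality W → (c d : W) (ps : List W) → OffPath c d ps ⊎ Σ _ (OnPath c d ps)
  OffPath? _≟_ c d [] = inj₁ tt
  OffPath? _≟_ c d (x ∷ []) = inj₁ tt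
  OffPath? _≟_ c d (x ∷ y ∷ r) with SameEdge? _≟_ x y c d | OffPath? _≟_ c d (y ∷ r)
  ... | yes s | _ = inj₂ (zero , SameEdge-sym s)
  ... | no ns | inj₁ off = inj₁ (ns , off)
  ... | no ns | inj₂ (i , s) = inj₂ (suc i , s)

  OffPath-∉ : ∀ {w c d} (xs : List W) → All (w ≢_) xs → w ≡ c ⊎ w ≡ d → OffPath c d xs
  OffPath-∉ [] _ _ = tt
  OffPath-∉ (x ∷ []) _ _ = tt
  OffPath-∉ {w} {c} {d} (x ∷ y ∷ r) (w≢x ∷ w≢y ∷ w∉) w∈cd = xy≢cd w∈cd , OffPath-∉ (y ∷ r) (w≢y ∷ w∉) w∈cd
    where
    xy≢cd : w ≡ c ⊎ w ≡ d → ¬ SameEdge x y c d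
    xy≢cd (inj₁ refl) = ∉⇒¬SameEdge w≢x w≢y
    xy≢cd (inj₂ refl) s = ∉⇒¬SameEdge w≢x w≢y (SameEdge-swapʳ s)

  Path-OffPath : ∀ {K : W → W → Set} {u v x y xs} → Path (Minus K u v) x y xs → OffPath u v xs
  Path-OffPath pnil = tt
  Path-OffPath (pcons (_ , n) pnil) = n , tt
  Path-OffPath (pcons (_ , n) (pcons r p)) = n , Path-OffPath (pcons r p)

  first-off-path : DecidableEquality W → (ps : List W) {Q : W × W → Set} (k : W × W) (ks : List (W × W)) → All Q (k ∷ ks) →
    (Σ W λ y → Σ W λ z → Q (y , z) × OffPath y z ps) ⊎ (Q k × Σ _ (OnPath (proj₁ k) (proj₂ k) ps))
  first-off-path _≟_ ps {Q} (y , z) ks (qk ∷ qks) with OffPath? _≟_ y z ps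
  ... | inj₁ off = inj₁ (y , z , qk , off)
  ... | inj₂ on = rest ks qks
    where
    rest : (ks : List (W × W)) → All Q ks → (Σ W λ y → Σ W λ z → Q (y , z) × OffPath y z ps) ⊎ (Q (y , z) × Σ _ (OnPath y z ps))
    rest [] [] = inj₂ (qk , on)
    rest ((y′ , z′) ∷ ks) (q ∷ qs) with OffPath? _≟_ y′ z′ ps
    ... | inj₁ off = inj₁ (y′ , z′ , q , off)
    ... | inj₂ _ = rest ks qs

-- One regrafting step on the level of graphs: T lies over (W, K), T₁ lies over (W, K′), and K′ is K
-- with uv moved to tv along the path P.
module Step {L : ℕ} (T T₁ : Phylo L) (G : Graph L) where
  open Graph G renaming (R to K; R-sym to K-sym)

  with-edges : (K′ : W → W → Set) → (∀ {x y} → K′ x y → K′ y x) → Graph L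
  with-edges K′ K′-sym = record { W = W ; R = K′ ; R-sym = K′-sym ; _≟_ = _≟_ ; label = label }

  record StepData : Set₁ where
    field
      K′ : W → W → Set
      K′-sym : ∀ {x y} → K′ x y → K′ y x
      u v t : W
      K′⇒ : ∀ {p q} → K′ p q → (K p q × ¬ SameEdge p q u v) ⊎ SameEdge p q t v
      K⇒K′ : ∀ {p q} → K p q → ¬ SameEdge p q u v → K′ p q
      t~′v : K′ t v
      u~v : K u v
      ps : List W
      P : Path (Minus K u v) u t ps
      v∉P : All (v ≢_) ps
      t∉side : ¬ Side K u v t
      link : Link.Link T G
      link₁ : Link.Link T₁ (with-edges K′ K′-sym)
      -- When u is smoothed away in T₁, only one of its two K′-edges is off P.
      at-u-unique : ∀ {y z y′ z′} → K′ y z → OffPath y z ps → Link.AtX T₁ (with-edges K′ K′-sym) link₁ y z →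
        K′ y′ z′ → OffPath y′ z′ ps → Link.AtX T₁ (with-edges K′ K′-sym) link₁ y′ z′ → SameEdge y z y′ z′

  module Transfer (D : StepData) where
    open StepData D
    open Regraft _≟_ K K′ K-sym K′-sym u v t K′⇒ K⇒K′ t~′v u~v ps P v∉P t∉side
    module L = Link T G
    module L₁ = Link T₁ (with-edges K′ K′-sym)

    n : ℕ
    n = length (edges ps)

    Moves : W → W → W → W → Set
    Moves y z y′ z′ = ((y ≡ u × z ≡ v) × (y′ ≡ t × z′ ≡ v)) ⊎ ((y ≡ v × z ≡ u) × (y′ ≡ v × z′ ≡ t)) ⊎
                      (¬ SameEdge y z u v × y′ ≡ y × z′ ≡ z)

    Moves-side : ∀ {y z y′ z′} → K y z → OffPath y z ps → Moves y z y′ z′ → ∀ w → Side K y z w ⇔ Side K′ y′ z′ w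
    Moves-side r off (inj₁ ((refl , refl) , (refl , refl))) w = side-moved , side-moved⁻
    Moves-side r off (inj₂ (inj₁ ((refl , refl) , (refl , refl)))) w = side-moved-opp , side-moved-opp⁻
    Moves-side {y} {z} r off (inj₂ (inj₂ (ns , refl , refl))) w = side , side⁻
      where open OffPathEdge y z ns (K-edge≢tv r ns) off

    Moves-adj : ∀ {y z y′ z′} → K y z → Moves y z y′ z′ → K′ y′ z′
    Moves-adj r (inj₁ ((refl , refl) , (refl , refl))) = t~′v
    Moves-adj r (inj₂ (inj₁ ((refl , refl) , (refl , refl)))) = K′-sym t~′v
    Moves-adj r (inj₂ (inj₂ (ns , refl , refl))) = K⇒K′ r ns

    Moves-injective : ∀ {y z y′ z′ a b a′ b′} → K y z → K a b → Moves y z y′ z′ → Moves a b a′ b′ →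
      SameEdge y′ z′ a′ b′ → SameEdge y z a b
    Moves-injective r₁ r₂ (inj₁ ((refl , refl) , _)) (inj₁ ((refl , refl) , _)) s = SameEdge-refl
    Moves-injective r₁ r₂ (inj₁ ((refl , refl) , _)) (inj₂ (inj₁ ((refl , refl) , _))) s = inj₂ (refl , refl)
    Moves-injective r₁ r₂ (inj₂ (inj₁ ((refl , refl) , _))) (inj₁ ((refl , refl) , _)) s = inj₂ (refl , refl)
    Moves-injective r₁ r₂ (inj₂ (inj₁ ((refl , refl) , _))) (inj₂ (inj₁ ((refl , refl) , _))) s = SameEdge-refl
    Moves-injective r₁ r₂ (inj₁ (_ , (refl , refl))) (inj₂ (inj₂ (ns , refl , refl))) s =
      ⊥-elim (K-edge≢tv r₂ ns (SameEdge-sym s))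
    Moves-injective r₁ r₂ (inj₂ (inj₁ (_ , (refl , refl)))) (inj₂ (inj₂ (ns , refl , refl))) s =
      ⊥-elim (K-edge≢tv r₂ ns (SameEdge-swapʳ (SameEdge-sym s)))
    Moves-injective r₁ r₂ (inj₂ (inj₂ (ns , refl , refl))) (inj₁ (_ , (refl , refl))) s = ⊥-elim (K-edge≢tv r₁ ns s)
    Moves-injective r₁ r₂ (inj₂ (inj₂ (ns , refl , refl))) (inj₂ (inj₁ (_ , (refl , refl)))) s =
      ⊥-elim (K-edge≢tv r₁ ns (SameEdge-swapʳ s))
    Moves-injective r₁ r₂ (inj₂ (inj₂ (_ , refl , refl))) (inj₂ (inj₂ (_ , refl , refl))) s = s

    Moves-OffPath : ∀ {y z y′ z′} → OffPath y z ps → Moves y z y′ z′ → OffPath y′ z′ ps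
    Moves-OffPath off (inj₁ (_ , (refl , refl))) = OffPath-∉ ps v∉P (inj₂ refl)
    Moves-OffPath off (inj₂ (inj₁ (_ , (refl , refl)))) = OffPath-∉ ps v∉P (inj₁ refl)
    Moves-OffPath off (inj₂ (inj₂ (_ , refl , refl))) = off

    Moves-total : ∀ y z → Σ W λ y′ → Σ W λ z′ → Moves y z y′ z′
    Moves-total y z with SameEdge? _≟_ y z u v
    ... | yes (inj₁ (refl , refl)) = t , v , inj₁ ((refl , refl) , (refl , refl))
    ... | yes (inj₂ (refl , refl)) = v , t , inj₂ (inj₁ ((refl , refl) , (refl , refl)))
    ... | no ns = y , z , inj₂ (inj₂ (ns , refl , refl))

    Moves-surjective : ∀ {y′ z′} → K′ y′ z′ → OffPath y′ z′ ps →
      Σ W λ y → Σ W λ z → K y z × OffPath y z ps × Moves y z y′ z′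
    Moves-surjective {y′} {z′} r off with K′⇒ r
    ... | inj₁ (r′ , ns) = y′ , z′ , r′ , off , inj₂ (inj₂ (ns , refl , refl))
    ... | inj₂ (inj₁ (refl , refl)) = u , v , u~v , Path-OffPath P , inj₁ ((refl , refl) , (refl , refl))
    ... | inj₂ (inj₂ (refl , refl)) = v , u , K-sym u~v , OffPath-∉ ps v∉P (inj₁ refl) ,
                                     inj₂ (inj₁ ((refl , refl) , (refl , refl)))

    SameSplit-across : ∀ {p q a b y z y′ z′} → L.Over link p q y z → K y z → OffPath y z ps → Moves y z y′ z′ →
      L₁.Over link₁ a b y′ z′ → SameSplit T T₁ p q a b
    SameSplit-across {y = y} {z} {y′} {z′} o r off m o₁ = sameSplit λ ℓ →
      ⇔-trans (L.Over-side link o (Phylo.lab T ℓ)) (⇔-trans moved (⇔-sym (L₁.Over-side link₁ o₁ (Phylo.lab T₁ ℓ))))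
      where
      moved : ∀ {ℓ} → Side K y z (L.embed link (Phylo.lab T ℓ)) ⇔ Side K′ y′ z′ (L₁.embed link₁ (Phylo.lab T₁ ℓ))
      moved {ℓ} rewrite L.embed-lab link ℓ | L₁.embed-lab link₁ ℓ = Moves-side r off m (label ℓ)

    forward : Forward T T₁ n
    forward = record
      { Charged = λ p q i → Σ W λ y → Σ W λ z → L.Over link p q y z × OnPath y z ps i
      ; Carried = Carried
      ; classify = classify
      ; charged-unique = λ { (_ , _ , o , s) (_ , _ , o′ , s′) → L.Over-injective link o o′ (SameEdge-trans s (SameEdge-sym s′)) }
      ; carried-injective = carried-injective
      }
      where
      Carried : Phylo.V T → Phylo.V T → Phylo.V T₁ → Phylo.V T₁ → Set
      Carried p q a b = Σ W λ y → Σ W λ z → Σ W λ y′ → Σ W λ z′ →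
        L.Over link p q y z × K y z × OffPath y z ps × Moves y z y′ z′ × L₁.Over link₁ a b y′ z′
      classify : ∀ {p q} → Phylo._~_ T p q → (Σ (Fin n) λ i → Σ W λ y → Σ W λ z → L.Over link p q y z × OnPath y z ps i) ⊎
        (Σ (Phylo.V T₁) λ a → Σ (Phylo.V T₁) λ b → Carried p q a b × Phylo._~_ T₁ a b × SameSplit T T₁ p q a b)
      classify {p} {q} r with L.Over-candidates link r
      ... | k , ks , over with first-off-path _≟_ ps k ks over
      ...   | inj₂ (o , i , s) = inj₁ (i , proj₁ k , proj₂ k , o , s)
      ...   | inj₁ (y , z , o , off) with Moves-total y z
      ...     | y′ , z′ , m with L₁.Over-surjective link₁ (Moves-adj (L.Over-adj link r o) m)
      ...       | a , b , o₁ = inj₂ (a , b , (y , z , y′ , z′ , o , L.Over-adj link r o , off , m , o₁) ,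
                      L₁.Over-adj⁻ link₁ (Moves-adj (L.Over-adj link r o) m) o₁ ,
                      SameSplit-across o (L.Over-adj link r o) off m o₁)
      carried-injective : ∀ {p q a b p′ q′ a′ b′} → Carried p q a b → Carried p′ q′ a′ b′ →
        SameEdge a b a′ b′ → SameEdge p q p′ q′
      carried-injective (_ , _ , _ , _ , o , r , off , m , o₁) (_ , _ , _ , _ , o′ , r′ , off′ , m′ , o₁′) s
        with L₁.Over-functional link₁ o₁ o₁′ s
      ... | inj₁ s′ = L.Over-injective link o o′ (Moves-injective r r′ m m′ s′)
      ... | inj₂ (at , at′) = L.Over-injective link o o′ (Moves-injective r r′ m m′
              (at-u-unique (Moves-adj r m) (Moves-OffPath off m) at (Moves-adj r′ m′) (Moves-OffPath off′ m′) at′))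

    backward : Backward T T₁ n
    backward = record
      { Charged = λ a b i → Σ W λ y → Σ W λ z → L₁.Over link₁ a b y z × OnPath y z ps i
      ; classify = classify
      ; charged-unique = λ { (_ , _ , o , s) (_ , _ , o′ , s′) → L₁.Over-injective link₁ o o′ (SameEdge-trans s (SameEdge-sym s′)) }
      }
      where
      classify : ∀ {a b} → Phylo._~_ T₁ a b → (Σ (Fin n) λ i → Σ W λ y → Σ W λ z → L₁.Over link₁ a b y z × OnPath y z ps i) ⊎
        (Σ (Phylo.V T) λ p → Σ (Phylo.V T) λ q → Phylo._~_ T p q × SameSplit T₁ T a b p q)
      classify {a} {b} r with L₁.Over-candidates link₁ r
      ... | k , ks , over with first-off-path _≟_ ps k ks over
      ...   | inj₂ (o , i , s) = inj₁ (i , proj₁ k , proj₂ k , o , s)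
      ...   | inj₁ (y′ , z′ , o₁ , off′) with Moves-surjective (L₁.Over-adj link₁ r o₁) off′
      ...     | y , z , ryz , off , m with L.Over-surjective link ryz
      ...       | p , q , o = inj₂ (p , q , L.Over-adj⁻ link ryz o , SameSplit-sym (SameSplit-across o ryz off m o₁))

module ChargeOrCarry {A B : Set} {n : ℕ} (D : A → A → Set) (DB : B → B → Set)
  (Charged : A → Fin n → Set) (Carried : A → B → Set)
  (charged-unique : ∀ {x y i} → Charged x i → Charged y i → D x y → ⊥)
  (carried-injective : ∀ {x y b c} → Carried x b → Carried y c → D x y → DB b c) where

  Classified : A → Set
  Classified x = Σ (Fin n) (Charged x) ⊎ Σ B (Carried x)

  private
    Token : Set
    Token = Σ A λ x → Σ (Fin n) (Charged x)

    Partition : List A → Set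
    Partition xs = Σ (List Token) λ cs → Σ (List B) λ ys →
      AllPairs (λ c c′ → D (proj₁ c) (proj₁ c′)) cs × AllPairs DB ys × All (λ b → Σ A λ x → Carried x b) ys ×
      length xs ≡ length cs + length ys ×
      (∀ z → All (D z) xs → All (λ c → D z (proj₁ c)) cs × (∀ b → Carried z b → All (DB b) ys))

    partition : (xs : List A) → AllPairs D xs → All Classified xs → Partition xs
    partition [] [] [] = [] , [] , [] , [] , [] , refl , (λ z _ → [] , λ _ _ → [])
    partition (x ∷ xs) (Dx ∷ Dxs) (inj₁ (i , ch) ∷ cl) with partition xs Dxs cl
    ... | cs , ys , Dcs , DBys , carried , len , distinct =
      (x , i , ch) ∷ cs , ys , proj₁ (distinct x Dx) ∷ Dcs , DBys , carried , cong suc len ,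
      λ { z (Dzx ∷ Dz) → (Dzx ∷ proj₁ (distinct z Dz)) , proj₂ (distinct z Dz) }
    partition (x ∷ xs) (Dx ∷ Dxs) (inj₂ (b , ca) ∷ cl) with partition xs Dxs cl
    ... | cs , ys , Dcs , DBys , carried , len , distinct =
      cs , b ∷ ys , Dcs , proj₂ (distinct x Dx) b ca ∷ DBys , (x , ca) ∷ carried ,
      trans (cong suc len) (sym (+-suc (length cs) (length ys))) ,
      λ { z (Dzx ∷ Dz) → proj₁ (distinct z Dz) , λ b′ ca′ → carried-injective ca′ ca Dzx ∷ proj₂ (distinct z Dz) b′ ca′ }

  count : (xs : List A) → AllPairs D xs → All Classified xs →
    Σ (List B) λ ys → AllPairs DB ys × All (λ b → Σ A λ x → Carried x b) ys × length xs ≤ n + length ys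
  count xs Dxs cl with partition xs Dxs cl
  ... | cs , ys , Dcs , DBys , carried , len , _ = ys , DBys , carried ,
    subst (_≤ n + length ys) (sym len) (+-mono-≤ (AllPairs-length≤ {D = λ c c′ → D (proj₁ c) (proj₁ c′)} token (λ {c} {c′} → token-distinct {c} {c′}) cs Dcs) ≤-refl)
    where
    token : Token → Fin n
    token (_ , i , _) = i
    token-distinct : ∀ {c c′ : Token} → D (proj₁ c) (proj₁ c′) → token c ≢ token c′
    token-distinct {_ , i , ch} {_ , .i , ch′} d refl = charged-unique ch ch′ d

module NonShared {L : ℕ} (T′ : Phylo L) where

  NonSharedEdge : (T T₂ : Phylo L) → Phylo.V T × Phylo.V T → Set
  NonSharedEdge T T₂ (a , b) = Phylo._~_ T a b × ¬ Shared T T₂ a b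

  Distinct : {V : Set} → V × V → V × V → Set
  Distinct (p , q) (p′ , q′) = ¬ SameEdge p q p′ q′

  module _ {T T₁ : Phylo L} {n : ℕ} (F : Forward T T₁ n) where
    private
      module F = Forward F

      Carried : Phylo.V T × Phylo.V T → Phylo.V T₁ × Phylo.V T₁ → Set
      Carried (p , q) (a , b) = F.Carried p q a b × Phylo._~_ T₁ a b × SameSplit T T₁ p q a b × ¬ Shared T T′ p q

      Charged : Phylo.V T × Phylo.V T → Fin n → Set
      Charged (p , q) i = F.Charged p q i

      charged-unique : ∀ {x y i} → Charged x i → Charged y i → Distinct x y → ⊥
      charged-unique c c′ ns = ns (F.charged-unique c c′)

      carried-injective : ∀ {x y e e′} → Carried x e → Carried y e′ → Distinct x y → Distinct e e′
      carried-injective (ca , _) (ca′ , _) ns s = ns (F.carried-injective ca ca′ s)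

      open ChargeOrCarry Distinct Distinct Charged Carried charged-unique carried-injective

      classify : ∀ {es} → All (NonSharedEdge T T′) es → All Classified es
      classify [] = []
      classify ((r , ns) ∷ al) with F.classify r
      ... | inj₁ charged = inj₁ charged ∷ classify al
      ... | inj₂ (a , b , ca , r₁ , s) = inj₂ ((a , b) , ca , r₁ , s , ns) ∷ classify al

      carried-nonShared : ∀ {es₁} → All (λ e → Σ _ λ e′ → Carried e′ e) es₁ → All (NonSharedEdge T₁ T′) es₁
      carried-nonShared [] = []
      carried-nonShared ((_ , _ , r₁ , s , ns) ∷ al) = (r₁ , λ sh → ns (Shared-transport {T₃ = T′} s sh)) ∷ carried-nonShared al

    nonShared-step : ∀ es → NonSharedEdges T T′ es →
      Σ (List (Phylo.V T₁ × Phylo.V T₁)) λ es₁ → NonSharedEdges T₁ T′ es₁ × length es ≤ n + length es₁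
    nonShared-step es (al , distinct) with count es distinct (classify al)
    ... | es₁ , distinct₁ , carried , len = es₁ , (carried-nonShared carried , distinct₁) , len

  -- An edge of T′ not shared with T is either not shared with T₁ either, or shares its split with an edge of T₁
  -- that must then be charged; two such edges of T′ on one token would have equal splits.
  module _ {T T₁ : Phylo L} {n : ℕ} (B : Backward T T₁ n) where
    private
      module B = Backward B
      module T′ = Phylo T′

      Charged : T′.V × T′.V → Fin n → Set
      Charged (c , d) i = Σ (Phylo.V T₁) λ a → Σ (Phylo.V T₁) λ b →
        T′._~_ c d × Phylo._~_ T₁ a b × SameSplit T′ T₁ c d a b × B.Charged a b i

      Kept : T′.V × T′.V → T′.V × T′.V → Set
      Kept (c , d) (c′ , d′) = c ≡ c′ × d ≡ d′ × T′._~_ c d × ¬ Shared T′ T₁ c d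

      charged-unique : ∀ {x y i} → Charged x i → Charged y i → Distinct x y → ⊥
      charged-unique (a , b , r , r₁ , s , ch) (a′ , b′ , r′ , r₁′ , s′ , ch′) ns with B.charged-unique ch ch′
      ... | inj₁ (refl , refl) = ns (Phylogeny.SameSplit-injective T′ r r′ (SameSplit-trans s (SameSplit-sym s′)))
      ... | inj₂ (refl , refl) = ns (SameEdge-swapʳ (Phylogeny.SameSplit-injective T′ r (T′.~-sym r′)
              (SameSplit-trans s (SameSplit-sym (SameSplit-flip r′ r₁′ s′)))))

      kept-injective : ∀ {x y e e′} → Kept x e → Kept y e′ → Distinct x y → Distinct e e′
      kept-injective (refl , refl , _) (refl , refl , _) ns = ns

      open ChargeOrCarry Distinct Distinct Charged Kept charged-unique kept-injective

      classify-shared : ∀ {c d a b} → T′._~_ c d → ¬ Shared T′ T c d → Phylo._~_ T₁ a b → SameSplit T′ T₁ c d a b →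
        ¬ ¬ Classified (c , d)
      classify-shared {c} {d} {a} {b} r ns r₁ s with B.classify r₁
      ... | inj₁ (i , ch) = return (inj₁ (i , a , b , r , r₁ , s , ch))
      ... | inj₂ (p , q , rpq , s′) = λ _ → ns (p , q , rpq , inj₁ (split (SameSplit-trans s s′)))

      classify : ∀ {e} → NonSharedEdge T′ T e → ¬ ¬ Classified e
      classify {c , d} (r , ns) = ¬¬-excluded-middle >>= λ
        { (no ns₁) → return (inj₂ ((c , d) , refl , refl , r , ns₁))
        ; (yes (a , b , r₁ , inj₁ s)) → classify-shared r ns r₁ (sameSplit s)
        ; (yes (a , b , r₁ , inj₂ s)) → classify-shared r ns (Phylo.~-sym T₁ r₁) (sameSplit s) }

      kept-nonShared : ∀ {es₁} → All (λ e → Σ _ λ e′ → Kept e′ e) es₁ → All (NonSharedEdge T′ T₁) es₁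
      kept-nonShared [] = []
      kept-nonShared ((_ , refl , refl , r , ns) ∷ al) = (r , ns) ∷ kept-nonShared al

    nonShared⁻-step : ∀ es → NonSharedEdges T′ T es →
      ¬ ¬ (Σ (List (T′.V × T′.V)) λ es₁ → NonSharedEdges T′ T₁ es₁ × length es ≤ n + length es₁)
    nonShared⁻-step es (al , distinct) = mapM 0ℓ ¬¬-Monad classify al >>= λ classified →
      let (es₁ , distinct₁ , kept , len) = count es distinct classified in
      return (es₁ , (kept-nonShared kept , distinct₁) , len)

Path-suffix : {V : Set} {R : V → V → Set} → ∀ {x y z xs} → Path R x y (x ∷ xs) → z ∈ xs →
  Σ (List V) λ ys → Σ (Path R z y ys) λ _ → length (edges ys) < length (edges (x ∷ xs)) × (∀ {w} → All (w ≢_) xs → All (w ≢_) ys)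
Path-suffix (pcons r pnil) (here refl) = _ , pnil , s≤s z≤n , λ w∉ → w∉
Path-suffix (pcons r (pcons r′ p)) (here refl) = _ , pcons r′ p , ≤-refl , λ w∉ → w∉
Path-suffix (pcons r (pcons r′ p)) (there z∈) with Path-suffix (pcons r′ p) z∈
... | ys , q , shorter , sub = ys , q , ≤-trans shorter (n≤1+n _) , λ { (_ ∷ w∉) → sub w∉ }

-- Revisiting u would give a shorter path, and meeting v would put t on the v-side of uv.
module ShortestPath {V : Set} {R : V → V → Set} (_≟_ : DecidableEquality V)
  (R-sym : ∀ {x y} → R x y → R y x) (irr : ∀ {x} → ¬ R x x) {u v t : V} {c : ℕ}
  (u~v : R u v) (t∉side : ¬ Side R u v t) (shortest : ShortestDist R u t c) where
  open DecMembership _≟_ using (_∈?_)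

  ps : List V
  ps = proj₁ (walk→path (proj₁ shortest))

  private
    path : Path R u t ps
    path = proj₂ (walk→path (proj₁ shortest))

    u∉tail : ∀ {xs} → Path R u t (u ∷ xs) → length (edges (u ∷ xs)) ≡ c → All (u ≢_) xs
    u∉tail {xs} p len with u ∈? xs
    ... | no u∉ = ¬Any⇒All¬ xs u∉
    ... | yes u∈ with Path-suffix p u∈
    ...   | _ , q , shorter , _ = ⊥-elim (<-irrefl refl (<-≤-trans (subst (_ <_) len shorter) (proj₂ shortest _ (path→walk q))))

    v∉path : ∀ {xs} → Path R u t (u ∷ xs) → length (edges (u ∷ xs)) ≡ c → All (v ≢_) (u ∷ xs)
    v∉path {xs} p len with v ∈? (u ∷ xs)
    ... | no v∉ = ¬Any⇒All¬ (u ∷ xs) v∉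
    ... | yes (here refl) = ⊥-elim (irr u~v)
    ... | yes (there v∈) with Path-suffix p v∈
    ...   | _ , q , _ , sub = ⊥-elim (t∉side (reverse (Minus-sym R-sym) (path→reach (Path-avoid-edge q (sub (u∉tail p len))))))

    starts-at-u : ∀ {xs} → Path R u t xs → Σ (List V) λ ys → xs ≡ u ∷ ys
    starts-at-u pnil = _ , refl
    starts-at-u (pcons _ _) = _ , refl

  edges-length : length (edges ps) ≡ c
  edges-length = walk→path-edges (proj₁ shortest)

  v∉P : All (v ≢_) ps
  v∉P with starts-at-u path
  ... | _ , e = subst (All (v ≢_)) (sym e) (v∉path (subst (Path R u t) e path) (trans (cong (λ xs → length (edges xs)) (sym e)) edges-length))

  P : Path (Minus R u v) u t ps
  P = Path-mono (λ { (r , n₁ , n₂) → r , λ { (inj₁ (_ , e)) → n₂ (sym e) ; (inj₂ (e , _)) → n₁ (sym e) } }) (Path-avoid path v∉P)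

Transfer : ∀ {L} → Phylo L → Phylo L → ℕ → Set₁
Transfer T T₁ c = Σ ℕ λ n → n ≤ c × Forward T T₁ n × Backward T T₁ n

↔⇒GraphIso : ∀ {L} {T : Phylo L} {G : Graph L} (bij : Phylo.V T ↔ Graph.W G) →
  (∀ {p q} → Phylo._~_ T p q → Graph.R G (Inverse.to bij p) (Inverse.to bij q)) →
  (∀ {p q} → Graph.R G (Inverse.to bij p) (Inverse.to bij q) → Phylo._~_ T p q) →
  (∀ ℓ → Inverse.to bij (Phylo.lab T ℓ) ≡ Graph.label G ℓ) → GraphIso T G
↔⇒GraphIso bij adj adj⁻ labels = record
  { ι = Inverse.to bij
  ; ι-injective = Function.Bundles.Injection.injective (↔⇒↣ bij)
  ; ι-surjective = λ w → Inverse.from bij w , Inverse.strictlyInverseˡ bij w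
  ; ι-adj = adj
  ; ι-adj⁻ = adj⁻
  ; ι-lab = labels }

labelled : ∀ {L} (W : Set) → (W → W → Set) → (Fin L → W) → LGraph L
labelled W K label = record { W = W ; adj = K ; IsLab = λ ℓ w → w ≡ label ℓ }

-- A leaf twin would carry the same label; an internal one would close a 4-cycle p x q y.
no-twins : ∀ {L} (H : Phylo L) {p q : Phylo.V H} → p ≢ q →
  (∀ z → Phylo._~_ H p z → Phylo._~_ H q z) → (∀ z → Phylo._~_ H q z → Phylo._~_ H p z) →
  (∀ i j → Phylo.lab H i ≡ p → Phylo.lab H j ≡ q → i ≡ j) → ⊥
no-twins H {p} {q} p≢q p⇒q q⇒p same-label = ¬¬-excluded-middle λ
  { (yes leaf) → leaf-case leaf
  ; (no ¬leaf) → internal-case (internal-deg p ¬leaf) }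
  where
  open Phylo H
  open Phylogeny H using (~⇒≢)
  leaf-case : IsLeaf _~_ p → ⊥
  leaf-case (z , pz , only-z) with leaf-lab p (z , pz , only-z) | leaf-lab q (z , p⇒q z pz , λ w qw → only-z w (q⇒p w qw))
  ... | i , e₁ | j , e₂ with same-label i j e₁ e₂
  ...   | refl = p≢q (trans (sym e₁) e₂)
  internal-case : DegGE3 _~_ p → ⊥
  internal-case (x , y , _ , px , py , _ , x≢y , _ , _) =
    acyclic (p , x ∷ q ∷ y ∷ [] ,
      (~⇒≢ px ∷ p≢q ∷ ~⇒≢ py ∷ []) ∷ ((λ e → ~⇒≢ (p⇒q x px) (sym e)) ∷ x≢y ∷ []) ∷ (~⇒≢ (p⇒q y py) ∷ []) ∷ [] ∷ [] ,
      s≤s (s≤s z≤n) ,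
      px , ~-sym (p⇒q x px) , p⇒q y py , ~-sym py , tt)

-- The common part of both kinds of STT operation: T lies over (W, K), and H is (W, K′) with u suppressed
-- when it has degree 2, where K′ moves the edge uv to tv along a shortest path from u to t.
module RegraftStep {L : ℕ} (T H : Phylo L) (G : Graph L) where
  open Graph G renaming (R to K; R-sym to K-sym)
  module H = Phylo H

  module _ (K-irrefl : ∀ {x} → ¬ K x x) (K-no-triangle : ∀ {x y z} → K x y → K y z → K z x → ⊥)
    (link : Link.Link T G) (label-injective : ∀ {i j} → label i ≡ label j → i ≡ j)
    (K′ : W → W → Set) (u v t : W)
    (K′⇒ : ∀ {p q} → K′ p q → (K p q × ¬ SameEdge p q u v) ⊎ SameEdge p q t v)
    (⇒K′ : ∀ {p q} → (K p q × ¬ SameEdge p q u v) ⊎ SameEdge p q t v → K′ p q)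
    (u~v : K u v) (t∉side : ¬ Side K u v t) (c : ℕ) (shortest : ShortestDist K u t c)
    (suppressed : Suppress (labelled W K′ label) u H)
    (t≢u-if-smoothed : (Σ W λ p → Σ W λ q → TwoNbrs (labelled W K′ label) u p q) → t ≢ u) where

    K′-sym : ∀ {x y} → K′ x y → K′ y x
    K′-sym r with K′⇒ r
    ... | inj₁ (r′ , ns) = ⇒K′ (inj₁ (K-sym r′ , λ s → ns (SameEdge-swapˡ s)))
    ... | inj₂ s = ⇒K′ (inj₂ (SameEdge-swapˡ s))

    private
      t≢v : t ≢ v
      t≢v refl = t∉side ε

      u≢v : u ≢ v
      u≢v refl = K-irrefl u~v

      K′-irrefl : ∀ {x} → ¬ K′ x x
      K′-irrefl r with K′⇒ r
      ... | inj₁ (r′ , _) = K-irrefl r′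
      ... | inj₂ (inj₁ (refl , refl)) = t≢v refl
      ... | inj₂ (inj₂ (refl , refl)) = t≢v refl

      G′ : Graph L
      G′ = Step.with-edges T H G K′ K′-sym

      module S = ShortestPath _≟_ K-sym K-irrefl u~v t∉side shortest

      u-nbr : t ≢ u → ∀ {w} → K′ u w → K u w
      u-nbr t≢u r with K′⇒ r
      ... | inj₁ (r′ , _) = r′
      ... | inj₂ (inj₁ (e , _)) = ⊥-elim (t≢u (sym e))
      ... | inj₂ (inj₂ (e , _)) = ⊥-elim (u≢v e)

      u≁′v : t ≢ u → ¬ K′ u v
      u≁′v t≢u r with K′⇒ r
      ... | inj₁ (_ , ns) = ns SameEdge-refl
      ... | inj₂ (inj₁ (e , _)) = t≢u (sym e)
      ... | inj₂ (inj₂ (e , _)) = u≢v e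

    module Smoothed (n₁ n₂ : W) (two : TwoNbrs (labelled W K′ label) u n₁ n₂)
      (I : Iso H (Merge (labelled W K′ label) u n₁ n₂)) where
      open Iso I

      private
        t≢u : t ≢ u
        t≢u = t≢u-if-smoothed (n₁ , n₂ , two)

        ι : H.V → W
        ι p = proj₁ (Inverse.to bij p)

        -- Equal images under ι differ at most in the (irrelevant) proof of ≢ u, so they are twins.
        ι-injective : ∀ {p q} → ι p ≡ ι q → p ≡ q
        ι-injective {p} {q} e with Phylogeny._≟_ H p q
        ... | yes p≡q = p≡q
        ... | no p≢q = ⊥-elim (no-twins H p≢q
                (λ z r → adj-from (subst (λ w → K′ w (ι z) ⊎ SameEdge w (ι z) n₁ n₂) e (adj-to r)))
                (λ z r → adj-from (subst (λ w → K′ w (ι z) ⊎ SameEdge w (ι z) n₁ n₂) (sym e) (adj-to r)))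
                (λ i j e₁ e₂ → label-injective (trans (sym (labels i)) (trans (cong ι e₁) (trans e (trans (cong ι (sym e₂)) (labels j)))))))

        n₁≢n₂ : n₁ ≢ n₂
        n₁≢n₂ = proj₁ two
        u~n₁ : K′ u n₁
        u~n₁ = proj₁ (proj₂ two)
        u~n₂ : K′ u n₂
        u~n₂ = proj₁ (proj₂ (proj₂ two))
        u-nbrs : ∀ w → K′ u w → w ≡ n₁ ⊎ w ≡ n₂
        u-nbrs = proj₂ (proj₂ (proj₂ two))

        n₁≁n₂ : ¬ K′ n₁ n₂
        n₁≁n₂ r with K′⇒ r
        ... | inj₁ (r′ , _) = K-no-triangle (u-nbr t≢u u~n₁) r′ (K-sym (u-nbr t≢u u~n₂))
        ... | inj₂ (inj₁ (_ , refl)) = u≁′v t≢u u~n₂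
        ... | inj₂ (inj₂ (refl , _)) = u≁′v t≢u u~n₁

      smoothing : Smoothing H G′
      smoothing = record
        { ι = ι
        ; ι-injective = ι-injective
        ; x = u
        ; ι≢x = λ p → proj₂ (Inverse.to bij p)
        ; ι-surjective = λ w w≢u → Inverse.from bij (w , w≢u) , cong proj₁ (Inverse.strictlyInverseˡ bij (w , w≢u))
        ; n₁ = n₁ ; n₂ = n₂ ; n₁≢n₂ = n₁≢n₂
        ; n₁≢x = λ e → K′-irrefl (subst (K′ u) e u~n₁)
        ; n₂≢x = λ e → K′-irrefl (subst (K′ u) e u~n₂)
        ; x~n₁ = u~n₁ ; x~n₂ = u~n₂ ; x-nbrs = u-nbrs ; n₁≁n₂ = n₁≁n₂
        ; ι-adj = adj-to
        ; ι-adj⁻ = λ r → adj-from (inj₁ r)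
        ; ι-merged⁻ = λ s → adj-from (inj₂ s)
        ; ι-lab = labels }

      private
        first-hop : Σ W λ p₁ → Σ (List W) λ rest → S.ps ≡ u ∷ p₁ ∷ rest × K′ u p₁
        first-hop = go S.P
          where
          go : ∀ {xs} → Path (Minus K u v) u t xs → Σ W λ p₁ → Σ (List W) λ rest → xs ≡ u ∷ p₁ ∷ rest × K′ u p₁
          go pnil = ⊥-elim (t≢u refl)
          go (pcons (r , ns) pnil) = _ , _ , refl , ⇒K′ (inj₁ (r , ns))
          go (pcons (r , ns) (pcons _ _)) = _ , _ , refl , ⇒K′ (inj₁ (r , ns))

        other-nbr : ∀ {p₁ z z′} → (p₁ ≡ n₁ ⊎ p₁ ≡ n₂) → (z ≡ n₁ ⊎ z ≡ n₂) → (z′ ≡ n₁ ⊎ z′ ≡ n₂) →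
          z ≢ p₁ → z′ ≢ p₁ → z ≡ z′
        other-nbr _ (inj₁ refl) (inj₁ refl) _ _ = refl
        other-nbr _ (inj₂ refl) (inj₂ refl) _ _ = refl
        other-nbr (inj₁ refl) (inj₁ refl) (inj₂ refl) z≢ _ = ⊥-elim (z≢ refl)
        other-nbr (inj₂ refl) (inj₁ refl) (inj₂ refl) _ z′≢ = ⊥-elim (z′≢ refl)
        other-nbr (inj₁ refl) (inj₂ refl) (inj₁ refl) _ z′≢ = ⊥-elim (z′≢ refl)
        other-nbr (inj₂ refl) (inj₂ refl) (inj₁ refl) z≢ _ = ⊥-elim (z≢ refl)

        off-path-at-u : ∀ {y z} → K′ y z → OffPath y z S.ps → (y ≡ u ⊎ z ≡ u) →
          Σ W λ w → (w ≡ n₁ ⊎ w ≡ n₂) × w ≢ proj₁ first-hop × ((y ≡ u × z ≡ w) ⊎ (y ≡ w × z ≡ u))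
        off-path-at-u {y} {z} r off at-u with first-hop
        ... | p₁ , rest , eps , _ with subst (OffPath y z) eps off
        ...   | (not-first , _) with at-u
        ...     | inj₁ refl = z , u-nbrs z r , (λ { refl → not-first SameEdge-refl }) , inj₁ (refl , refl)
        ...     | inj₂ refl = y , u-nbrs y (K′-sym r) , (λ { refl → not-first (inj₂ (refl , refl)) }) , inj₂ (refl , refl)

      at-u-unique : ∀ {y z y′ z′} → K′ y z → OffPath y z S.ps → (y ≡ u ⊎ z ≡ u) →
        K′ y′ z′ → OffPath y′ z′ S.ps → (y′ ≡ u ⊎ z′ ≡ u) → SameEdge y z y′ z′
      at-u-unique r off at r′ off′ at′ with off-path-at-u r off at | off-path-at-u r′ off′ at′
      ... | w , w-nbr , w≢ , e | w′ , w′-nbr , w′≢ , e′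
        with other-nbr (u-nbrs _ (proj₂ (proj₂ (proj₂ first-hop)))) w-nbr w′-nbr w≢ w′≢
      ...   | refl with e | e′
      ...     | inj₁ (refl , refl) | inj₁ (refl , refl) = SameEdge-refl
      ...     | inj₁ (refl , refl) | inj₂ (refl , refl) = inj₂ (refl , refl)
      ...     | inj₂ (refl , refl) | inj₁ (refl , refl) = inj₂ (refl , refl)
      ...     | inj₂ (refl , refl) | inj₂ (refl , refl) = SameEdge-refl

    step-data : Suppress (labelled W K′ label) u H → Step.StepData T H G
    step-data s = record
      { K′ = K′ ; K′-sym = K′-sym ; u = u ; v = v ; t = t
      ; K′⇒ = K′⇒ ; K⇒K′ = λ r ns → ⇒K′ (inj₁ (r , ns)) ; t~′v = ⇒K′ (inj₂ SameEdge-refl) ; u~v = u~v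
      ; ps = S.ps ; P = S.P ; v∉P = S.v∉P ; t∉side = t∉side
      ; link = link ; link₁ = proj₁ (link₁ s) ; at-u-unique = proj₂ (link₁ s) }
      where
      link₁ : (s : Suppress (labelled W K′ label) u H) → Σ (Link.Link H G′) λ l → ∀ {y z y′ z′} →
        K′ y z → OffPath y z S.ps → Link.AtX H G′ l y z → K′ y′ z′ → OffPath y′ z′ S.ps → Link.AtX H G′ l y′ z′ →
        SameEdge y z y′ z′
      link₁ (inj₂ (_ , I)) = inj₁ (↔⇒GraphIso (Iso.bij I) (Iso.adj-to I) (Iso.adj-from I) (Iso.labels I)) , λ _ _ ()
      link₁ (inj₁ (n₁ , n₂ , two , I)) = inj₂ (Smoothed.smoothing n₁ n₂ two I) , Smoothed.at-u-unique n₁ n₂ two I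

    transfer : Transfer T H c
    transfer = Step.Transfer.n T H G D , ≤-reflexive S.edges-length ,
               Step.Transfer.forward T H G D , Step.Transfer.backward T H G D
      where
      D : Step.StepData T H G
      D = step-data suppressed

module STTStep {L : ℕ} (T : Phylo L) where
  open Phylo T
  open STTDefs T
  open Phylogeny T using (_≟_; ~⇒≢; no-triangle)

  regraftNode-transfer : ∀ {H c} (u v : V) → u ~ v → (t : V) → ¬ IsLeaf _~_ t → ¬ Side _~_ u v t →
    ShortestDist _~_ u t c → Suppress (regraftNode u v t) u H → Transfer T H c
  regraftNode-transfer {H} {c} u v u~v t internal t∉side shortest suppressed =
    RegraftStep.transfer T H (phylo-graph T) ~-irrefl no-triangle (inj₁ identity) lab-inj K′ u v t (λ r → r) (λ r → r)
      u~v t∉side c shortest suppressed t≢u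
    where
    K′ : V → V → Set
    K′ p q = (p ~ q × ¬ SameEdge p q u v) ⊎ SameEdge p q t v

    identity : GraphIso T (phylo-graph T)
    identity = record
      { ι = λ p → p ; ι-injective = λ e → e ; ι-surjective = λ w → w , refl
      ; ι-adj = λ r → r ; ι-adj⁻ = λ r → r ; ι-lab = λ ℓ → refl }

    -- t keeps its ≥ 3 neighbours in K′, so u = t could not be suppressed.
    t≢u : (Σ V λ p → Σ V λ q → TwoNbrs (labelled V K′ lab) u p q) → t ≢ u
    t≢u (p , q , _ , _ , _ , u-nbrs) refl with internal-deg t internal
    ... | x₁ , x₂ , x₃ , r₁ , r₂ , r₃ , n₁₂ , n₁₃ , n₂₃ = pigeonhole (u-nbrs x₁ (keep r₁)) (u-nbrs x₂ (keep r₂)) (u-nbrs x₃ (keep r₃))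
      where
      keep : ∀ {x} → t ~ x → K′ t x
      keep {x} r with SameEdge? _≟_ t x t v
      ... | yes s = inj₂ s
      ... | no ns = inj₁ (r , ns)
      pigeonhole : (x₁ ≡ p ⊎ x₁ ≡ q) → (x₂ ≡ p ⊎ x₂ ≡ q) → (x₃ ≡ p ⊎ x₃ ≡ q) → ⊥
      pigeonhole (inj₁ a) (inj₁ b) _ = n₁₂ (trans a (sym b))
      pigeonhole (inj₂ a) (inj₂ b) _ = n₁₂ (trans a (sym b))
      pigeonhole (inj₁ a) _ (inj₁ b) = n₁₃ (trans a (sym b))
      pigeonhole (inj₂ a) _ (inj₂ b) = n₁₃ (trans a (sym b))
      pigeonhole _ (inj₁ a) (inj₁ b) = n₂₃ (trans a (sym b))
      pigeonhole _ (inj₂ a) (inj₂ b) = n₂₃ (trans a (sym b))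

  -- T is the subdivision of ab by the new vertex nothing, with nothing smoothed away.
  module Subdivision {a b : V} (a~b : a ~ b) where

    K : Maybe V → Maybe V → Set
    K = subAdj a b

    K-sym : ∀ {x y} → K x y → K y x
    K-sym {just p} {just q} (r , ns) = ~-sym r , λ s → ns (SameEdge-swapˡ s)
    K-sym {nothing} {just q} r = r
    K-sym {just p} {nothing} r = r

    K-irrefl : ∀ {x} → ¬ K x x
    K-irrefl {just p} (r , _) = ~-irrefl r
    K-irrefl {nothing} ()

    private
      within-ab : ∀ {y z} → (y ≡ a ⊎ y ≡ b) → (z ≡ a ⊎ z ≡ b) → y ~ z → SameEdge y z a b
      within-ab (inj₁ refl) (inj₁ refl) r = ⊥-elim (~-irrefl r)
      within-ab (inj₁ refl) (inj₂ refl) r = SameEdge-refl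
      within-ab (inj₂ refl) (inj₁ refl) r = inj₂ (refl , refl)
      within-ab (inj₂ refl) (inj₂ refl) r = ⊥-elim (~-irrefl r)

    K-no-triangle : ∀ {x y z} → K x y → K y z → K z x → ⊥
    K-no-triangle {just x} {just y} {just z} (r₁ , _) (r₂ , _) (r₃ , _) = no-triangle r₁ r₂ r₃
    K-no-triangle {nothing} {just y} {just z} r₁ (r₂ , ns) r₃ = ns (within-ab r₁ r₃ r₂)
    K-no-triangle {just x} {nothing} {just z} r₁ r₂ (r₃ , ns) = ns (within-ab r₂ r₁ r₃)
    K-no-triangle {just x} {just y} {nothing} (r₁ , ns) r₂ r₃ = ns (within-ab r₃ r₂ r₁)
    K-no-triangle {nothing} {nothing} {_} () _ _
    K-no-triangle {_} {nothing} {nothing} _ () _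
    K-no-triangle {nothing} {just _} {nothing} _ _ ()

    graph : Graph L
    graph = record { W = Maybe V ; R = K ; R-sym = λ {x} {y} → K-sym {x} {y} ; _≟_ = Maybe-≟ _≟_ ; label = λ ℓ → just (lab ℓ) }

    smoothing : Smoothing T graph
    smoothing = record
      { ι = just ; ι-injective = just-injective ; x = nothing ; ι≢x = λ p () ; ι-surjective = preimage
      ; n₁ = just a ; n₂ = just b ; n₁≢n₂ = λ e → ~⇒≢ a~b (just-injective e) ; n₁≢x = λ () ; n₂≢x = λ ()
      ; x~n₁ = inj₁ refl ; x~n₂ = inj₂ refl ; x-nbrs = x-nbrs ; n₁≁n₂ = λ r → proj₂ r SameEdge-refl
      ; ι-adj = adj ; ι-adj⁻ = proj₁ ; ι-merged⁻ = merged⁻ ; ι-lab = λ ℓ → refl }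
      where
      preimage : ∀ w → w ≢ nothing → Σ V λ p → just p ≡ w
      preimage (just w) _ = w , refl
      preimage nothing w≢ = ⊥-elim (w≢ refl)
      x-nbrs : ∀ w → K nothing w → w ≡ just a ⊎ w ≡ just b
      x-nbrs (just w) (inj₁ e) = inj₁ (cong just e)
      x-nbrs (just w) (inj₂ e) = inj₂ (cong just e)
      adj : ∀ {p q} → p ~ q → K (just p) (just q) ⊎ SameEdge (just p) (just q) (just a) (just b)
      adj {p} {q} r with SameEdge? _≟_ p q a b
      ... | yes s = inj₂ (SameEdge-map just s)
      ... | no ns = inj₁ (r , ns)
      merged⁻ : ∀ {p q} → SameEdge (just p) (just q) (just a) (just b) → p ~ q
      merged⁻ s with SameEdge-injective just just-injective s
      ... | inj₁ (refl , refl) = a~b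
      ... | inj₂ (refl , refl) = ~-sym a~b

  module _ {u v a b : V} where

    private
      K K′ : Maybe V → Maybe V → Set
      K = subAdj a b
      K′ = regraftEdgeAdj u v a b

    regraftEdge-K′⇒ : ∀ {p q} → K′ p q → (K p q × ¬ SameEdge p q (just u) (just v)) ⊎ SameEdge p q nothing (just v)
    regraftEdge-K′⇒ {just p} {just q} (r , ns) = inj₁ (r , λ s → ns (SameEdge-injective just just-injective s))
    regraftEdge-K′⇒ {nothing} {just q} (inj₁ e) = inj₁ (inj₁ e , λ { (inj₁ (() , _)) ; (inj₂ (() , _)) })
    regraftEdge-K′⇒ {nothing} {just q} (inj₂ (inj₁ e)) = inj₁ (inj₂ e , λ { (inj₁ (() , _)) ; (inj₂ (() , _)) })
    regraftEdge-K′⇒ {nothing} {just q} (inj₂ (inj₂ e)) = inj₂ (inj₁ (refl , cong just e))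
    regraftEdge-K′⇒ {just p} {nothing} (inj₁ e) = inj₁ (inj₁ e , λ { (inj₁ (_ , ())) ; (inj₂ (_ , ())) })
    regraftEdge-K′⇒ {just p} {nothing} (inj₂ (inj₁ e)) = inj₁ (inj₂ e , λ { (inj₁ (_ , ())) ; (inj₂ (_ , ())) })
    regraftEdge-K′⇒ {just p} {nothing} (inj₂ (inj₂ e)) = inj₂ (inj₂ (cong just e , refl))
    regraftEdge-K′⇒ {nothing} {nothing} ()

    ⇒regraftEdge-K′ : ∀ {p q} → (K p q × ¬ SameEdge p q (just u) (just v)) ⊎ SameEdge p q nothing (just v) → K′ p q
    ⇒regraftEdge-K′ {just p} {just q} (inj₁ (r , ns)) = r , λ s → ns (SameEdge-map just s)
    ⇒regraftEdge-K′ {nothing} {just q} (inj₁ (inj₁ e , _)) = inj₁ e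
    ⇒regraftEdge-K′ {nothing} {just q} (inj₁ (inj₂ e , _)) = inj₂ (inj₁ e)
    ⇒regraftEdge-K′ {just p} {nothing} (inj₁ (inj₁ e , _)) = inj₁ e
    ⇒regraftEdge-K′ {just p} {nothing} (inj₁ (inj₂ e , _)) = inj₂ (inj₁ e)
    ⇒regraftEdge-K′ {nothing} {nothing} (inj₁ (() , _))
    ⇒regraftEdge-K′ {nothing} {just q} (inj₂ (inj₁ (_ , e))) = inj₂ (inj₂ (just-injective e))
    ⇒regraftEdge-K′ {just p} {nothing} (inj₂ (inj₂ (e , _))) = inj₂ (inj₂ (just-injective e))
    ⇒regraftEdge-K′ {just p} {just q} (inj₂ (inj₁ (() , _)))
    ⇒regraftEdge-K′ {just p} {just q} (inj₂ (inj₂ (_ , ())))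
    ⇒regraftEdge-K′ {nothing} {nothing} (inj₂ (inj₁ (_ , ())))
    ⇒regraftEdge-K′ {nothing} {nothing} (inj₂ (inj₂ (() , _)))
    ⇒regraftEdge-K′ {nothing} {just q} (inj₂ (inj₂ (() , _)))
    ⇒regraftEdge-K′ {just p} {nothing} (inj₂ (inj₁ (() , _)))

  regraftEdge-transfer : ∀ {H c} (u v : V) → u ~ v → (a b : V) → (a~b : a ~ b) →
    ¬ Side _~_ u v a → ¬ Side _~_ u v b →
    ShortestDist (subAdj a b) (just u) nothing c → Suppress (regraftEdge u v a b) (just u) H → Transfer T H c
  regraftEdge-transfer {H} {c} u v u~v a b a~b a∉side b∉side shortest suppressed =
    RegraftStep.transfer T H graph (λ {x} → K-irrefl {x}) (λ {x} {y} {z} → K-no-triangle {x} {y} {z}) (inj₂ smoothing)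
      (λ e → lab-inj (just-injective e)) (regraftEdgeAdj u v a b) (just u) (just v) nothing
      (λ {p} {q} → regraftEdge-K′⇒ {p = p} {q}) (λ {p} {q} → ⇒regraftEdge-K′ {p = p} {q})
      ju~jv nothing∉side c shortest suppressed (λ _ ())
    where
    open Subdivision a~b
    ab≢uv : ¬ SameEdge a b u v
    ab≢uv (inj₁ (refl , refl)) = b∉side ε
    ab≢uv (inj₂ (refl , refl)) = a∉side ε
    ju~jv : K (just u) (just v)
    ju~jv = u~v , λ s → ab≢uv (SameEdge-sym s)
    -- nothing lies between a and b, both off the v-side of uv.
    nothing∉side : ¬ Side K (just u) (just v) nothing
    nothing∉side s = a∉side (reach-map to-T hop s)
      where
      to-T : Maybe V → V
      to-T (just p) = p
      to-T nothing = a
      hop : ∀ {y z} → Minus K (just u) (just v) y z → Reach (Minus _~_ u v) (to-T y) (to-T z)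
      hop {just p} {just q} ((r , _) , ns) = single (r , λ s → ns (SameEdge-map just s))
      hop {nothing} {just q} (inj₁ refl , _) = ε
      hop {nothing} {just q} (inj₂ refl , _) = single (a~b , ab≢uv)
      hop {just p} {nothing} (inj₁ refl , _) = ε
      hop {just p} {nothing} (inj₂ refl , _) = single (~-sym a~b , λ s → ab≢uv (SameEdge-swapˡ s))
      hop {nothing} {nothing} (() , _)

STT⇒Transfer : ∀ {L} {T T₁ : Phylo L} {c} → STT T T₁ c → Transfer T T₁ c
STT⇒Transfer {T = T} (u , v , u~v , inj₂ (t , internal , t∉side , shortest , suppressed)) =
  STTStep.regraftNode-transfer T u v u~v t internal t∉side shortest suppressed
STT⇒Transfer {T = T} (u , v , u~v , inj₁ (a , b , a~b , a∉side , b∉side , shortest , suppressed)) =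
  STTStep.regraftEdge-transfer T u v u~v a b a~b a∉side b∉side shortest suppressed

module _ {L : ℕ} {H T′ : Phylo L} (I : Iso H (toLGraph T′)) where
  private
    module H = Phylo H
    module T′ = Phylo T′

    iso : GraphIso H (phylo-graph T′)
    iso = ↔⇒GraphIso (Iso.bij I) (Iso.adj-to I) (Iso.adj-from I) (λ ℓ → sym (Iso.labels I ℓ))
    open GraphIso iso
    open GraphIso-Side H (phylo-graph T′) iso

    ι-split : ∀ {a b} → SameSplit H T′ a b (ι a) (ι b)
    ι-split {a} {b} = sameSplit λ ℓ →
      (λ s → subst (Side T′._~_ (ι a) (ι b)) (ι-lab ℓ) (side s)) ,
      (λ s → side⁻ (subst (Side T′._~_ (ι a) (ι b)) (sym (ι-lab ℓ)) s))

  iso-shared : ∀ {a b} → a H.~ b → Shared H T′ a b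
  iso-shared {a} {b} r = ι a , ι b , ι-adj r , inj₁ (split ι-split)

  iso-shared⁻ : ∀ {c d} → c T′.~ d → Shared T′ H c d
  iso-shared⁻ {c} {d} r with ι-surjective c | ι-surjective d
  ... | p , refl | q , refl = p , q , ι-adj⁻ r , inj₁ (split (SameSplit-sym ι-split))

all-shared⇒no-nonShared : ∀ {L} {T T′ : Phylo L} → (∀ {a b} → Phylo._~_ T a b → Shared T T′ a b) →
  ∀ es → NonSharedEdges T T′ es → length es ≤ 0
all-shared⇒no-nonShared shared [] _ = z≤n
all-shared⇒no-nonShared shared (_ ∷ _) ((r , ¬shared) ∷ _ , _) = ⊥-elim (¬shared (shared r))

module _ {L : ℕ} (T′ : Phylo L) where
  open NonShared T′

  nonShared-bound : ∀ {T H c} → STTSeq T H c → Iso H (toLGraph T′) → ∀ es → NonSharedEdges T T′ es → length es ≤ c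
  nonShared-bound {T} done I es ns = all-shared⇒no-nonShared {T = T} {T′} (iso-shared {T′ = T′} I) es ns
  nonShared-bound (step stt seq) I es ns with STT⇒Transfer stt
  ... | n , n≤c , F , _ with nonShared-step F es ns
  ...   | es₁ , ns₁ , len = ≤-trans len (+-mono-≤ n≤c (nonShared-bound seq I es₁ ns₁))

  -- Sharedness is undecidable here, hence ¬ ¬; the decidability of ≤ removes it at the end.
  nonShared⁻-bound : ∀ {T H c} → STTSeq T H c → Iso H (toLGraph T′) → ∀ es → NonSharedEdges T′ T es → ¬ ¬ (length es ≤ c)
  nonShared⁻-bound {T} done I es ns = return (all-shared⇒no-nonShared {T = T′} {T} (iso-shared⁻ {T′ = T′} I) es ns)
  nonShared⁻-bound (step stt seq) I es ns with STT⇒Transfer stt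
  ... | n , n≤c , _ , B = nonShared⁻-step B es ns >>= λ (es₁ , ns₁ , len) →
    nonShared⁻-bound seq I es₁ ns₁ >>= λ bound → return (≤-trans len (+-mono-≤ n≤c bound))

lemma10 : ∀ {L d : ℕ} (T T' : Phylo L) → DegreeD d T → DegreeD d T' →
    ∀ (H : Phylo L) (c : ℕ) → STTSeq T H c → Iso H (toLGraph T') →
    ∀ (es : List (Phylo.V T × Phylo.V T)) (es' : List (Phylo.V T' × Phylo.V T')) →
    NonSharedEdges T T' es → NonSharedEdges T' T es' →
    length es ⊔ length es' ≤ c
lemma10 T T' _ _ H c seq I es es' ns ns' =
  ⊔-lub (nonShared-bound T' seq I es ns) (decidable-stable (_ ≤? c) (nonShared⁻-bound T' seq I es' ns'))
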